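{- Let $e$ be a resource expression with $e\asymp e$ and let $\bar t$ be a resource monomial. If $e'\in\mathrm{supp}(\partial_xe\cdot\bar t)$ then $(\partial_xe\cdot\bar t)_{e'}=\dfrac{m(e)\,m(\bar t)}{m(e')}$.
   Context: Resource terms and monomials: $s,t ::= x\mid\lambda x.s\mid\langle s\rangle\bar t\mid s\oplus\bullet\mid\bullet\oplus s$, $\bar t::=[t_1,\dots,t_n]$ (finite multisets), up to $\alpha$-equivalence; resource expressions are terms or monomials. Finite formal sums with coefficients in $\mathbb N$; $E_e$ is the coefficient of $e$, $\mathrm{supp}(E)$ the support; constructors extended by multilinearity. For $\bar u=[u_1,\dots,u_n]$, $\partial_xe\cdot\bar u$: $\partial_xy\cdot\bar u$ is $y$ if $y\ne x$ and $n=0$, $u_1$ if $y=x$ and $n=1$, $0$ otherwise; $\partial_x(\lambda y.s)\cdot\bar u=\lambda y.(\partial_xs\cdot\bar u)$ ($y$ fresh), $\partial_x(s\oplus\bullet)\cdot\bar u=(\partial_xs\cdot\bar u)\oplus\bullet$, $\partial_x(\bullet\oplus s)\cdot\bar u=\bullet\oplus(\partial_xs\cdot\bar u)$; $\partial_x(\langle s\rangle\bar t)\cdot\bar u=\sum_{(I_1,I_2)}\langle\partial_xs\cdot\bar u_{I_1}\rangle(\partial_x\bar t\cdot\bar u_{I_2})$; $\partial_x[t_1,\dots,t_k]\cdot\bar u=\sum_{(I_1,\dots,I_k)}[\partial_xt_1\cdot\bar u_{I_1},\dots,\partial_xt_k\cdot\bar u_{I_k}]$, sums over tuples of pairwise disjoint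 possibly empty subsets of $\{1,\dots,n\}$ covering it, $\bar u_I=[u_i\mid i\in I]$. Coherence $\asymp$: $x\asymp x$; $\lambda x.s\asymp\lambda x.s'$ if $s\asymp s'$; $\langle s\rangle\bar t\asymp\langle s'\rangle\bar t'$ if $s\asymp s'$ and $\bar t\asymp\bar t'$; $[t_1,\dots,t_n]\asymp[t_{n+1},\dots,t_{n+m}]$ if $t_i\asymp t_j$ for all $1\le i,j\le n+m$; $s\oplus\bullet\asymp s'\oplus\bullet$ and $\bullet\oplus s\asymp\bullet\oplus s'$ if $s\asymp s'$; $s\oplus\bullet\asymp\bullet\oplus s'$ for all $s,s'$ (symmetric). Multiplicity: $m(x)=1$; $m(\lambda x.s)=m(s\oplus\bullet)=m(\bullet\oplus s)=m(s)$; $m(\langle s\rangle\bar t)=m(s)m(\bar t)$; $m([t_1]^{n_1}\cdot\ldots\cdot[t_k]^{n_k})=\prod_{i=1}^kn_i!\,m(t_i)^{n_i}$ for pairwise distinct $t_i$ ($[t]^n$: $n$ copies of $t$; $\cdot$ multiset union). -}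

module Defs where

open import Data.Nat using (ℕ; zero; suc; _+_; _*_; _^_; _<ᵇ_; _≡ᵇ_)
open import Data.Nat using (_!)
open import Data.Bool using (Bool; true; false; _∧_; if_then_else_)
open import Data.List using (List; []; _∷_; _++_; map; concatMap; length; filter; null; allFin)
open import Data.List.Relation.Unary.All using (All)
open import Data.Maybe using (Maybe; just; nothing; maybe)
open import Data.Product using (_×_; _,_)
open import Data.Vec using (Vec; []; _∷_; replicate; updateAt; lookup)
open import Data.Fin using (Fin; zero; suc)
open import Data.Bool using (T)

-- Resource terms, in de Bruijn notation (this quotients by α-equivalence).
-- Monomials [t₁,…,tₙ] are represented by lists; they are identified up to
-- permutation by the equivalence _==ᵉ_ below.

data Term : Set where
  var : ℕ → Term
  lam : Term → Term
  app : Term → List Term → Term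
  inl : Term → Term              -- s ⊕ •
  inr : Term → Term              -- • ⊕ s

Monomial : Set
Monomial = List Term

data Expr : Set where
  term : Term → Expr
  mono : Monomial → Expr

-- finite formal sums with coefficients in ℕ: a list, each element counted once
Sum : Set → Set
Sum A = List A

mutual
  _==_ : Term → Term → Bool
  var i == var j = i ≡ᵇ j
  lam s == lam s' = s == s'
  app s ts == app s' ts' = (s == s') ∧ bagEq ts ts'
  inl s == inl s' = s == s'
  inr s == inr s' = s == s'
  _ == _ = false

  bagEq : List Term → List Term → Bool
  bagEq [] us = null us
  bagEq (t ∷ ts) us = maybe (bagEq ts) false (remove t us)

  remove : Term → List Term → Maybe (List Term)
  remove t [] = nothing
  remove t (u ∷ us) = if t == u then just us else consM u (remove t us)

  consM : Term → Maybe (List Term) → Maybe (List Term)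
  consM u (just r) = just (u ∷ r)
  consM u nothing = nothing

_==ᵉ_ : Expr → Expr → Bool
term s ==ᵉ term s' = s == s'
mono ts ==ᵉ mono us = bagEq ts us
_ ==ᵉ _ = false

coeff : Sum Expr → Expr → ℕ
coeff E e = length (filter (λ d → T? (d ==ᵉ e)) E)
  where
  open import Relation.Nullary using (Dec)
  open import Data.Bool.Properties using () renaming (T? to T?)

-- Shifting (weakening) free indices ≥ c, used to keep ū's variables free
-- when going under a binder ("y fresh").

mutual
  shift : ℕ → Term → Term
  shift c (var i) = if i <ᵇ c then var i else var (suc i)
  shift c (lam s) = lam (shift (suc c) s)
  shift c (app s ts) = app (shift c s) (shiftL c ts)
  shift c (inl s) = inl (shift c s)
  shift c (inr s) = inr (shift c s)

  shiftL : ℕ → List Term → List Term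
  shiftL c [] = []
  shiftL c (t ∷ ts) = shift c t ∷ shiftL c ts

-- All tuples (I₁,…,I_k) of pairwise disjoint, possibly empty subsets of
-- the positions of ū covering all of them, given as the tuple of
-- sub-monomials (ū_{I₁},…,ū_{I_k}): each position is assigned to one part.

assignments : {A : Set} (k : ℕ) → List A → List (Vec (List A) k)
assignments k [] = replicate k [] ∷ []
assignments k (u ∷ us) =
  concatMap (λ v → map (λ i → updateAt v i (u ∷_)) (allFin k)) (assignments k us)

mutual
  ∂t : ℕ → Term → List Term → Sum Term
  ∂t x (var y) [] = if y ≡ᵇ x then [] else var y ∷ []
  ∂t x (var y) (u ∷ []) = if y ≡ᵇ x then u ∷ [] else []
  ∂t x (var y) (_ ∷ _ ∷ _) = []
  ∂t x (lam s) us = map lam (∂t (suc x) s (shiftL 0 us))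
  ∂t x (app s ts) us =
    concatMap (λ p → concatMap (λ a → map (λ b → app a b)
                                           (∂m x ts (lookup p (suc zero))))
                               (∂t x s (lookup p zero)))
              (assignments 2 us)
  ∂t x (inl s) us = map inl (∂t x s us)
  ∂t x (inr s) us = map inr (∂t x s us)

  ∂m : ℕ → List Term → List Term → Sum Monomial
  ∂m x ts us = concatMap (∂bag x ts) (assignments (length ts) us)

  ∂bag : ℕ → (ts : List Term) → Vec (List Term) (length ts) → Sum Monomial
  ∂bag x [] [] = [] ∷ []
  ∂bag x (t ∷ ts) (p ∷ ps) =
    concatMap (λ a → map (a ∷_) (∂bag x ts ps)) (∂t x t p)

∂ : ℕ → Expr → List Term → Sum Expr
∂ x (term s) us = map term (∂t x s us)
∂ x (mono ts) us = map mono (∂m x ts us)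

mutual
  data _≍_ : Term → Term → Set where
    var≍ : ∀ {i} → var i ≍ var i
    lam≍ : ∀ {s s'} → s ≍ s' → lam s ≍ lam s'
    app≍ : ∀ {s s' ts ts'} → s ≍ s' → ts ≍ᵇ ts' → app s ts ≍ app s' ts'
    inl≍ : ∀ {s s'} → s ≍ s' → inl s ≍ inl s'
    inr≍ : ∀ {s s'} → s ≍ s' → inr s ≍ inr s'
    inlr≍ : ∀ {s s'} → inl s ≍ inr s'
    inrl≍ : ∀ {s s'} → inr s ≍ inl s'

  data _≍ᵇ_ (ts us : List Term) : Set where
    bag≍ : All (λ a → All (λ b → a ≍ b) (ts ++ us)) (ts ++ us) → ts ≍ᵇ us

data _≍ᵉ_ : Expr → Expr → Set where
  term≍ : ∀ {s s'} → s ≍ s' → term s ≍ᵉ term s'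
  mono≍ : ∀ {ts us} → ts ≍ᵇ us → mono ts ≍ᵉ mono us

-- For a monomial, the elements are first annotated with
-- their multiplicity, then grouped into classes of equal terms
-- [t₁]^{n₁}·…·[t_k]^{n_k} (tᵢ pairwise distinct), and
-- m = ∏ nᵢ! · m(tᵢ)^{nᵢ}.

-- groups: (representative tᵢ, m(tᵢ), nᵢ)
insertG : Term × ℕ → List (Term × ℕ × ℕ) → List (Term × ℕ × ℕ)
insertG (t , k) [] = (t , k , 1) ∷ []
insertG (t , k) ((r , mr , n) ∷ gs) =
  if t == r then (r , mr , suc n) ∷ gs else (r , mr , n) ∷ insertG (t , k) gs

groupG : List (Term × ℕ) → List (Term × ℕ × ℕ)
groupG [] = []
groupG (p ∷ ps) = insertG p (groupG ps)

prodG : List (Term × ℕ × ℕ) → ℕ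
prodG [] = 1
prodG ((_ , mt , n) ∷ gs) = ((n !) * (mt ^ n)) * prodG gs

mutual
  m : Term → ℕ
  m (var _) = 1
  m (lam s) = m s
  m (app s ts) = m s * mBag ts
  m (inl s) = m s
  m (inr s) = m s

  mBag : List Term → ℕ
  mBag ts = prodG (groupG (annotate ts))

  annotate : List Term → List (Term × ℕ)
  annotate [] = []
  annotate (t ∷ ts) = (t , m t) ∷ annotate ts

mᵉ : Expr → ℕ
mᵉ (term s) = m s
mᵉ (mono ts) = mBag ts

-- Lemma 5.20: for a coherent resource expression e and a monomial ū, every
-- e' in the support of ∂ₓe·ū has coefficient m(e)·m(ū)/m(e'); stated without
-- division as  (∂ₓe·ū)_{e'} · m(e') = m(e) · m(ū).
--
-- Variables, abstractions and sums are then direct; an application combines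
-- rigidity with the splitting identity; a monomial t ∷ t̄ peels off t.
module Submission where

open import Defs
open import Data.Nat
open import Data.Nat.Properties
open import Data.Nat.Tactic.RingSolver using (solve-∀)
open import Algebra.Properties.CommutativeSemigroup +-commutativeSemigroup using () renaming (x∙yz≈y∙xz to +-leftComm; interchange to +-interchange)
open import Data.Bool using (Bool; true; false; if_then_else_; _∧_; T)
open import Data.Bool.Properties using (T-≡; ¬-not)
open import Data.List using (List; []; _∷_; _++_; map; concatMap; tabulate; allFin; length)
open import Data.Vec using (Vec; []; _∷_; updateAt; lookup)
open import Data.Fin using (Fin; zero; suc)
open import Data.Maybe using (Maybe; just; nothing; maybe)
import Data.Maybe as Maybe
open import Data.Maybe.Properties using (just-injective)
open import Data.Product using (Σ; _×_; _,_; proj₁; proj₂)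
open import Data.Sum using (_⊎_; inj₁; inj₂)
open import Data.Unit using (⊤; tt)
open import Data.Empty using (⊥-elim)
open import Function using (_∘_; id; Equivalence)
open import Relation.Binary.PropositionalEquality
open import Data.List.Relation.Unary.All as All using (All; []; _∷_)
open import Data.List.Relation.Unary.All.Properties using (++⁺)
open import Data.List.Relation.Unary.Any as Any using (here; there)
open import Data.List.Membership.Propositional using (_∈_)
open import Data.List.Membership.Propositional.Properties using (∈-++⁺ˡ; ∈-++⁺ʳ; ∈-++⁻; ∈-concatMap⁺)
open import Data.List.Relation.Binary.Permutation.Propositional
  using (_↭_; ↭-sym) renaming (refl to ↭r; prep to ↭p; swap to ↭s; trans to ↭t)
open import Data.List.Relation.Binary.Permutation.Propositional.Properties
  using (All-resp-↭; ↭-length; ∈-resp-↭)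

𝟙 : Bool → ℕ
𝟙 true = 1
𝟙 false = 0

false≢true : false ≢ true
false≢true ()

𝟙-pos : ∀ b → 0 < 𝟙 b → b ≡ true
𝟙-pos true _ = refl

𝟙+0-pos : ∀ b → 0 < 𝟙 b + 0 → b ≡ true
𝟙+0-pos true _ = refl

𝟙-∧ : ∀ a b → 𝟙 (a ∧ b) ≡ 𝟙 a * 𝟙 b
𝟙-∧ true b = sym (+-identityʳ _)
𝟙-∧ false b = refl

∧-true : ∀ {a b} → a ∧ b ≡ true → a ≡ true × b ≡ true
∧-true {true} {true} e = refl , refl

bool-ext : ∀ {a b : Bool} → (a ≡ true → b ≡ true) → (b ≡ true → a ≡ true) → a ≡ b
bool-ext {true} {true} f g = refl
bool-ext {true} {false} f g = ⊥-elim (false≢true (f refl))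
bool-ext {false} {true} f g = g refl
bool-ext {false} {false} f g = refl

-- sign c is 1 if c is positive and 0 otherwise.  Every coefficient law below
-- has the shape  c · m(e') = sign c · m(e) · m(ū).
sign : ℕ → ℕ
sign zero = 0
sign (suc _) = 1

sign-pos : ∀ {c} → 0 < c → sign c ≡ 1
sign-pos {suc c} _ = refl

sign-pos⁻ : ∀ c → 0 < sign c → 0 < c
sign-pos⁻ (suc c) _ = s≤s z≤n

sign-form : ∀ c k l → (0 < c → c * k ≡ l) → c * k ≡ sign c * l
sign-form zero k l f = refl
sign-form (suc c) k l f = trans (f (s≤s z≤n)) (sym (+-identityʳ l))

*-pos⁻ : ∀ m n → 0 < m * n → (0 < m) × (0 < n)
*-pos⁻ zero n ()
*-pos⁻ (suc m) zero h rewrite *-zeroʳ m = ⊥-elim (<-irrefl refl h)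
*-pos⁻ (suc m) (suc n) h = s≤s z≤n , s≤s z≤n

≡ᵇ-refl : ∀ i → (i ≡ᵇ i) ≡ true
≡ᵇ-refl i = Equivalence.to T-≡ (≡⇒≡ᵇ i i refl)

≡ᵇ-true⇒≡ : ∀ i j → (i ≡ᵇ j) ≡ true → i ≡ j
≡ᵇ-true⇒≡ i j e = ≡ᵇ⇒≡ i j (Equivalence.from T-≡ e)

≡ᵇ-sym : ∀ i j → (i ≡ᵇ j) ≡ (j ≡ᵇ i)
≡ᵇ-sym i j = bool-ext (λ e → sym-true (≡ᵇ-true⇒≡ i j e)) (λ e → sym-true (≡ᵇ-true⇒≡ j i e))
  where
  sym-true : ∀ {a b} → a ≡ b → (b ≡ᵇ a) ≡ true
  sym-true {a} refl = ≡ᵇ-refl a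

∑ : {A : Set} → (A → ℕ) → List A → ℕ
∑ f [] = 0
∑ f (x ∷ xs) = f x + ∑ f xs

∑-cong : {A : Set} {f g : A → ℕ} → (∀ x → f x ≡ g x) → ∀ xs → ∑ f xs ≡ ∑ g xs
∑-cong h [] = refl
∑-cong h (x ∷ xs) = cong₂ _+_ (h x) (∑-cong h xs)

∑-↭ : {A : Set} (f : A → ℕ) {xs ys : List A} → xs ↭ ys → ∑ f xs ≡ ∑ f ys
∑-↭ f ↭r = refl
∑-↭ f (↭p x p) = cong (f x +_) (∑-↭ f p)
∑-↭ f (↭s x y p) = trans (sym (+-assoc (f x) (f y) _)) (trans (cong₂ _+_ (+-comm (f x) (f y)) (∑-↭ f p)) (+-assoc (f y) (f x) _))
∑-↭ f (↭t p q) = trans (∑-↭ f p) (∑-↭ f q)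

∑-++ : {A : Set} (f : A → ℕ) (xs ys : List A) → ∑ f (xs ++ ys) ≡ ∑ f xs + ∑ f ys
∑-++ f [] ys = refl
∑-++ f (x ∷ xs) ys = trans (cong (f x +_) (∑-++ f xs ys)) (sym (+-assoc (f x) _ _))

∑-concatMap : {A B : Set} (f : B → ℕ) (g : A → List B) (xs : List A) → ∑ f (concatMap g xs) ≡ ∑ (λ x → ∑ f (g x)) xs
∑-concatMap f g [] = refl
∑-concatMap f g (x ∷ xs) = trans (∑-++ f (g x) (concatMap g xs)) (cong (∑ f (g x) +_) (∑-concatMap f g xs))

∑-map : {A B : Set} (f : B → ℕ) (g : A → B) (xs : List A) → ∑ f (map g xs) ≡ ∑ (f ∘ g) xs
∑-map f g [] = refl
∑-map f g (x ∷ xs) = cong (f (g x) +_) (∑-map f g xs)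

∑-+ : {A : Set} (f g : A → ℕ) (xs : List A) → ∑ (λ x → f x + g x) xs ≡ ∑ f xs + ∑ g xs
∑-+ f g [] = refl
∑-+ f g (x ∷ xs) rewrite ∑-+ f g xs = +-interchange (f x) (g x) (∑ f xs) (∑ g xs)

∑-*ˡ : {A : Set} (k : ℕ) (f : A → ℕ) (xs : List A) → ∑ (λ x → k * f x) xs ≡ k * ∑ f xs
∑-*ˡ k f [] = sym (*-zeroʳ k)
∑-*ˡ k f (x ∷ xs) rewrite ∑-*ˡ k f xs = sym (*-distribˡ-+ k (f x) _)

∑-*ʳ : {A : Set} (k : ℕ) (f : A → ℕ) (xs : List A) → ∑ (λ x → f x * k) xs ≡ ∑ f xs * k
∑-*ʳ k f [] = refl
∑-*ʳ k f (x ∷ xs) rewrite ∑-*ʳ k f xs = sym (*-distribʳ-+ k (f x) _)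

∑-zero : {A : Set} (f : A → ℕ) → (∀ x → f x ≡ 0) → (xs : List A) → ∑ f xs ≡ 0
∑-zero f h [] = refl
∑-zero f h (x ∷ xs) rewrite h x = ∑-zero f h xs

∑-*-zero : {A : Set} (f g : A → ℕ) (xs : List A) → ∑ f xs ≡ 0 → ∑ (λ x → f x * g x) xs ≡ 0
∑-*-zero f g [] e = refl
∑-*-zero f g (x ∷ xs) e with f x in q
... | zero = ∑-*-zero f g xs e
... | suc _ with e
...   | ()

∑-swap : {A B : Set} (f : A → B → ℕ) (xs : List A) (ys : List B) →
  ∑ (λ x → ∑ (λ y → f x y) ys) xs ≡ ∑ (λ y → ∑ (λ x → f x y) xs) ys
∑-swap f [] ys = sym (∑-zero _ (λ _ → refl) ys)
∑-swap f (x ∷ xs) ys = trans (cong (∑ (f x) ys +_) (∑-swap f xs ys)) (sym (∑-+ (f x) _ ys))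

∑-pos : {A : Set} (f : A → ℕ) (xs : List A) → 0 < ∑ f xs → Σ A (λ x → x ∈ xs × 0 < f x)
∑-pos f [] ()
∑-pos f (x ∷ xs) h with f x in q
... | suc _ = x , here refl , subst (0 <_) (sym q) (s≤s z≤n)
... | zero with ∑-pos f xs h
...   | y , y∈xs , p = y , there y∈xs , p

∑-≥ : {A : Set} (f : A → ℕ) {x : A} {xs : List A} → x ∈ xs → f x ≤ ∑ f xs
∑-≥ f {xs = y ∷ ys} (here refl) = m≤m+n (f y) _
∑-≥ f {xs = y ∷ ys} (there x∈ys) = ≤-trans (∑-≥ f x∈ys) (m≤n+m _ (f y))

∑Fin : (n : ℕ) → (Fin n → ℕ) → ℕ
∑Fin zero f = 0
∑Fin (suc n) f = f zero + ∑Fin n (f ∘ suc)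

∑Fin-cong : ∀ n {f g : Fin n → ℕ} → (∀ i → f i ≡ g i) → ∑Fin n f ≡ ∑Fin n g
∑Fin-cong zero h = refl
∑Fin-cong (suc n) h = cong₂ _+_ (h zero) (∑Fin-cong n (λ i → h (suc i)))

∑-tabulate : {A : Set} (g : A → ℕ) (n : ℕ) (f : Fin n → A) → ∑ g (tabulate f) ≡ ∑Fin n (g ∘ f)
∑-tabulate g zero f = refl
∑-tabulate g (suc n) f = cong (g (f zero) +_) (∑-tabulate g n (f ∘ suc))

∑Fin-swap : ∀ n (f : Fin n → Fin n → ℕ) → ∑Fin n (λ j → ∑Fin n (λ i → f j i)) ≡ ∑Fin n (λ i → ∑Fin n (λ j → f j i))
∑Fin-swap n f = begin
  ∑Fin n (λ j → ∑Fin n (f j))              ≡⟨ allFin-sum _ ⟩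
  ∑ (λ j → ∑Fin n (f j)) (allFin n)        ≡⟨ ∑-cong (λ j → allFin-sum (f j)) (allFin n) ⟩
  ∑ (λ j → ∑ (f j) (allFin n)) (allFin n)  ≡⟨ ∑-swap f (allFin n) (allFin n) ⟩
  ∑ (λ i → ∑ (λ j → f j i) (allFin n)) (allFin n)
    ≡⟨ sym (trans (allFin-sum _) (∑-cong (λ i → allFin-sum (λ j → f j i)) (allFin n))) ⟩
  ∑Fin n (λ i → ∑Fin n (λ j → f j i))      ∎
  where
  open ≡-Reasoning
  allFin-sum : (g : Fin n → ℕ) → ∑Fin n g ≡ ∑ g (allFin n)
  allFin-sum g = sym (∑-tabulate g n id)

module Bags {A : Set} (eq : A → A → Bool) (eqrefl : ∀ x → eq x x ≡ true) where
  consMaybe : A → Maybe (List A) → Maybe (List A)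
  consMaybe u (just r) = just (u ∷ r)
  consMaybe u nothing = nothing

  remove′ : A → List A → Maybe (List A)
  remove′ t [] = nothing
  remove′ t (u ∷ us) = if eq t u then just us else consMaybe u (remove′ t us)

  sameBag : List A → List A → Bool
  sameBag [] [] = true
  sameBag [] (_ ∷ _) = false
  sameBag (t ∷ ts) us = maybe (sameBag ts) false (remove′ t us)

  count : A → List A → ℕ
  count z = ∑ (λ y → 𝟙 (eq y z))

  remove′-just : ∀ t us {r} → remove′ t us ≡ just r → Σ A (λ u → eq t u ≡ true × us ↭ u ∷ r)
  remove′-just t [] ()
  remove′-just t (u ∷ us) e with eq t u in q
  ... | true with e
  ...   | refl = u , q , ↭r
  remove′-just t (u ∷ us) e | false with remove′ t us in q2
  ...   | just r' with e
  ...     | refl = let (w , a , p) = remove′-just t us q2 in w , a , ↭t (↭p u p) (↭s u w ↭r)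
  remove′-just t (u ∷ us) e | false | nothing with e
  ...     | ()

  record Regular (x : A) : Set where
    field
      reg-sym : ∀ y → eq x y ≡ eq y x
      reg-left : ∀ y z → eq x y ≡ true → eq y z ≡ eq x z
      reg-right : ∀ y z → eq x y ≡ true → eq z y ≡ eq z x
  open Regular

  Regular-== : ∀ {x y} → Regular x → eq x y ≡ true → Regular y
  Regular-== {x} {y} g e = record
    { reg-sym = λ w → trans (reg-left g y w e) (trans (reg-sym g w) (sym (reg-right g y w e)))
    ; reg-left = λ w z e2 → trans (reg-left g w z (trans (sym (reg-left g y w e)) e2)) (sym (reg-left g y z e))
    ; reg-right = λ w z e2 → trans (reg-right g w z (trans (sym (reg-left g y w e)) e2)) (sym (reg-right g y z e)) }

  remove′-nothing : ∀ t us → Regular t → remove′ t us ≡ nothing → count t us ≡ 0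
  remove′-nothing t [] g e = refl
  remove′-nothing t (u ∷ us) g e with eq t u in q
  ... | true with e
  ...   | ()
  remove′-nothing t (u ∷ us) g e | false with remove′ t us in q2
  ...   | nothing rewrite trans (sym (reg-sym g u)) q = remove′-nothing t us g q2
  ...   | just _ with e
  ...     | ()

  All-sameBag : (Q : A → Set) → (∀ {x y} → Q x → eq x y ≡ true → Q y) → ∀ xs ys → sameBag xs ys ≡ true → All Q xs → All Q ys
  All-sameBag Q cl [] [] e _ = []
  All-sameBag Q cl [] (_ ∷ _) () _
  All-sameBag Q cl (t ∷ ts) ys e (g ∷ gs) with remove′ t ys in q
  ... | just r = let (u , tu , p) = remove′-just t ys q in
        All-resp-↭ (↭-sym p) (cl g tu ∷ All-sameBag Q cl ts r e gs)
  ... | nothing = ⊥-elim (false≢true e)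

  Regular-sameBagʳ : ∀ xs ys → sameBag xs ys ≡ true → All Regular xs → All Regular ys
  Regular-sameBagʳ = All-sameBag Regular Regular-==

  Regular-sameBagˡ : ∀ xs ys → sameBag xs ys ≡ true → All Regular ys → All Regular xs
  Regular-sameBagˡ [] [] e _ = []
  Regular-sameBagˡ [] (_ ∷ _) () _
  Regular-sameBagˡ (t ∷ ts) ys e gys with remove′ t ys in q
  ... | just r = let (u , tu , p) = remove′-just t ys q in
        let gur = All-resp-↭ p gys in
        Regular-== (All.head gur) (trans (reg-sym (All.head gur) t) tu) ∷ Regular-sameBagˡ ts r e (All.tail gur)
  ... | nothing = ⊥-elim (false≢true e)

  sameBag⇒count : ∀ xs ys → All Regular xs → sameBag xs ys ≡ true → ∀ z → count z xs ≡ count z ys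
  sameBag⇒count [] [] _ _ z = refl
  sameBag⇒count [] (_ ∷ _) _ ()
  sameBag⇒count (t ∷ ts) ys (g ∷ gs) e z with remove′ t ys in q
  ... | just r = let (u , tu , p) = remove′-just t ys q in
     trans (cong₂ _+_ (cong 𝟙 (sym (reg-left g u z tu))) (sameBag⇒count ts r gs e z)) (sym (∑-↭ _ p))
  ... | nothing = ⊥-elim (false≢true e)

  count⇒sameBag : ∀ xs ys → All Regular xs → (∀ z → count z xs ≡ count z ys) → sameBag xs ys ≡ true
  count⇒sameBag [] [] _ _ = refl
  count⇒sameBag [] (y ∷ ys) _ h with eq y y | eqrefl y | h y
  ... | true | _ | ()
  ... | false | () | _
  count⇒sameBag (t ∷ ts) ys (g ∷ gs) h with remove′ t ys in q
  ... | just r = let (u , tu , p) = remove′-just t ys q in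
        count⇒sameBag ts r gs (λ z → +-cancelˡ-≡ (𝟙 (eq t z)) _ _
           (trans (h z) (trans (∑-↭ _ p) (cong (_+ count z r) (cong 𝟙 (reg-left g u z tu))))))
  ... | nothing with h t | remove′-nothing t ys g q
  ...   | ht | hz rewrite eqrefl t | hz with ht
  ...     | ()

  sameBag-sym : ∀ xs ys → All Regular xs → sameBag xs ys ≡ true → sameBag ys xs ≡ true
  sameBag-sym xs ys g e = count⇒sameBag ys xs (Regular-sameBagʳ xs ys e g) (λ z → sym (sameBag⇒count xs ys g e z))

  sameBag-trans : ∀ xs ys zs → All Regular xs → sameBag xs ys ≡ true → sameBag ys zs ≡ true → sameBag xs zs ≡ true
  sameBag-trans xs ys zs g e1 e2 = count⇒sameBag xs zs g (λ z → trans (sameBag⇒count xs ys g e1 z) (sameBag⇒count ys zs (Regular-sameBagʳ xs ys e1 g) e2 z))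

  sameBag-comm : ∀ xs ys → All Regular xs → sameBag xs ys ≡ sameBag ys xs
  sameBag-comm xs ys g = bool-ext (sameBag-sym xs ys g) (λ e → sameBag-sym ys xs (Regular-sameBagˡ ys xs e g) e)

  sameBag-substˡ : ∀ xs ys zs → All Regular xs → sameBag xs ys ≡ true → sameBag ys zs ≡ sameBag xs zs
  sameBag-substˡ xs ys zs g e = bool-ext (sameBag-trans xs ys zs g e) (λ e2 → sameBag-trans ys xs zs (Regular-sameBagʳ xs ys e g) (sameBag-sym xs ys g e) e2)

  sameBag-substʳ : ∀ xs ys zs → All Regular xs → sameBag xs ys ≡ true → sameBag zs ys ≡ sameBag zs xs
  sameBag-substʳ xs ys zs g e = bool-ext
    (λ e2 → let gz = Regular-sameBagˡ zs ys e2 (Regular-sameBagʳ xs ys e g) in sameBag-trans zs ys xs gz e2 (sameBag-sym xs ys g e))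
    (λ e2 → sameBag-trans zs xs ys (Regular-sameBagˡ zs xs e2 g) e2 e)

mutual
  ==-refl : ∀ t → (t == t) ≡ true
  ==-refl (var i) = ≡ᵇ-refl i
  ==-refl (lam s) = ==-refl s
  ==-refl (app s ts) rewrite ==-refl s = bagEq-refl ts
  ==-refl (inl s) = ==-refl s
  ==-refl (inr s) = ==-refl s

  bagEq-refl : ∀ ts → bagEq ts ts ≡ true
  bagEq-refl [] = refl
  bagEq-refl (t ∷ ts) rewrite ==-refl t = bagEq-refl ts

module TermBags = Bags _==_ ==-refl
open TermBags using (Regular; remove′; sameBag; count)
open Regular

remove≡remove′ : ∀ t us → remove t us ≡ remove′ t us
remove≡remove′ t [] = refl
remove≡remove′ t (u ∷ us) with t == u
... | true = refl
... | false rewrite remove≡remove′ t us with remove′ t us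
...   | just _ = refl
...   | nothing = refl

bagEq≡sameBag : ∀ ts us → bagEq ts us ≡ sameBag ts us
bagEq≡sameBag [] [] = refl
bagEq≡sameBag [] (_ ∷ _) = refl
bagEq≡sameBag (t ∷ ts) us rewrite remove≡remove′ t us with remove′ t us
... | just r = bagEq≡sameBag ts r
... | nothing = refl

record Head {P : Set} (eqP : P → P → Bool) (f : P → Term) : Set where
  field
    head-== : ∀ a b → (f a == f b) ≡ eqP a b
    head-view : ∀ y → Σ P (λ b → y ≡ f b) ⊎ (∀ a → (f a == y) ≡ false × (y == f a) ≡ false)

regular-head : ∀ {P eqP eqP-refl f} → Head eqP f → ∀ {s} → Bags.Regular {P} eqP eqP-refl s → Regular (f s)
regular-head {f = f} h {s} g = record { reg-sym = f-sym ; reg-left = f-left ; reg-right = f-right }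
  where
  open Head h
  open Bags.Regular g renaming (reg-sym to p-sym; reg-left to p-left; reg-right to p-right)
  f-sym : ∀ y → (f s == y) ≡ (y == f s)
  f-sym y with head-view y
  ... | inj₁ (b , refl) = trans (head-== s b) (trans (p-sym b) (sym (head-== b s)))
  ... | inj₂ other = trans (proj₁ (other s)) (sym (proj₂ (other s)))
  f-left : ∀ y z → (f s == y) ≡ true → (y == z) ≡ (f s == z)
  f-left y z e with head-view y
  ... | inj₂ other = ⊥-elim (false≢true (trans (sym (proj₁ (other s))) e))
  ... | inj₁ (b , refl) with head-view z
  ...   | inj₁ (c , refl) = trans (head-== b c) (trans (p-left b c (trans (sym (head-== s b)) e)) (sym (head-== s c)))
  ...   | inj₂ other = trans (proj₁ (other b)) (sym (proj₁ (other s)))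
  f-right : ∀ y z → (f s == y) ≡ true → (z == y) ≡ (z == f s)
  f-right y z e with head-view y
  ... | inj₂ other = ⊥-elim (false≢true (trans (sym (proj₁ (other s))) e))
  ... | inj₁ (b , refl) with head-view z
  ...   | inj₁ (c , refl) = trans (head-== c b) (trans (p-right b c (trans (sym (head-== s b)) e)) (sym (head-== c s)))
  ...   | inj₂ other = trans (proj₂ (other b)) (sym (proj₂ (other s)))

var-head : Head _≡ᵇ_ var
var-head = record { head-== = λ _ _ → refl ; head-view = view }
  where
  view : ∀ y → Σ ℕ (λ b → y ≡ var b) ⊎ (∀ a → (var a == y) ≡ false × (y == var a) ≡ false)
  view (var j) = inj₁ (j , refl)
  view (lam _) = inj₂ λ _ → refl , refl
  view (app _ _) = inj₂ λ _ → refl , refl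
  view (inl _) = inj₂ λ _ → refl , refl
  view (inr _) = inj₂ λ _ → refl , refl

lam-head : Head _==_ lam
lam-head = record { head-== = λ _ _ → refl ; head-view = view }
  where
  view : ∀ y → Σ Term (λ b → y ≡ lam b) ⊎ (∀ a → (lam a == y) ≡ false × (y == lam a) ≡ false)
  view (lam b) = inj₁ (b , refl)
  view (var _) = inj₂ λ _ → refl , refl
  view (app _ _) = inj₂ λ _ → refl , refl
  view (inl _) = inj₂ λ _ → refl , refl
  view (inr _) = inj₂ λ _ → refl , refl

inl-head : Head _==_ inl
inl-head = record { head-== = λ _ _ → refl ; head-view = view }
  where
  view : ∀ y → Σ Term (λ b → y ≡ inl b) ⊎ (∀ a → (inl a == y) ≡ false × (y == inl a) ≡ false)
  view (inl b) = inj₁ (b , refl)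
  view (var _) = inj₂ λ _ → refl , refl
  view (lam _) = inj₂ λ _ → refl , refl
  view (app _ _) = inj₂ λ _ → refl , refl
  view (inr _) = inj₂ λ _ → refl , refl

inr-head : Head _==_ inr
inr-head = record { head-== = λ _ _ → refl ; head-view = view }
  where
  view : ∀ y → Σ Term (λ b → y ≡ inr b) ⊎ (∀ a → (inr a == y) ≡ false × (y == inr a) ≡ false)
  view (inr b) = inj₁ (b , refl)
  view (var _) = inj₂ λ _ → refl , refl
  view (lam _) = inj₂ λ _ → refl , refl
  view (app _ _) = inj₂ λ _ → refl , refl
  view (inl _) = inj₂ λ _ → refl , refl

head-payload : ∀ {P eqP f} → Head {P} eqP f → ∀ {a} y → (f a == y) ≡ true → Σ P (λ b → y ≡ f b)
head-payload h {a} y e with Head.head-view h y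
... | inj₁ found = found
... | inj₂ other = ⊥-elim (false≢true (trans (sym (proj₁ (other a))) e))

ℕ-regular : ∀ i → Bags.Regular _≡ᵇ_ ≡ᵇ-refl i
ℕ-regular i = record
  { reg-sym = ≡ᵇ-sym i
  ; reg-left = λ j k e → cong (_≡ᵇ k) (sym (≡ᵇ-true⇒≡ i j e))
  ; reg-right = λ j k e → cong (k ≡ᵇ_) (sym (≡ᵇ-true⇒≡ i j e)) }

regular-app : ∀ s ts → Regular s → All Regular ts → Regular (app s ts)
regular-app s ts g gs = record { reg-sym = app-sym ; reg-left = app-left ; reg-right = app-right }
  where
  open TermBags using (sameBag-comm; sameBag-substˡ; sameBag-substʳ)
  bags : ∀ us → bagEq ts us ≡ true → sameBag ts us ≡ true
  bags us e = trans (sym (bagEq≡sameBag ts us)) e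
  app-sym : ∀ y → (app s ts == y) ≡ (y == app s ts)
  app-sym (app s' us) = cong₂ _∧_ (reg-sym g s') (trans (bagEq≡sameBag ts us) (trans (sameBag-comm ts us gs) (sym (bagEq≡sameBag us ts))))
  app-sym (var _) = refl
  app-sym (lam _) = refl
  app-sym (inl _) = refl
  app-sym (inr _) = refl
  app-left : ∀ y z → (app s ts == y) ≡ true → (y == z) ≡ (app s ts == z)
  app-left (app s' us) (app s'' vs) e = cong₂ _∧_ (reg-left g s' s'' (proj₁ (∧-true e)))
    (trans (bagEq≡sameBag us vs) (trans (sameBag-substˡ ts us vs gs (bags us (proj₂ (∧-true e)))) (sym (bagEq≡sameBag ts vs))))
  app-left (app _ _) (var _) e = refl
  app-left (app _ _) (lam _) e = refl
  app-left (app _ _) (inl _) e = refl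
  app-left (app _ _) (inr _) e = refl
  app-right : ∀ y z → (app s ts == y) ≡ true → (z == y) ≡ (z == app s ts)
  app-right (app s' us) (app s'' vs) e = cong₂ _∧_ (reg-right g s' s'' (proj₁ (∧-true e)))
    (trans (bagEq≡sameBag vs us) (trans (sameBag-substʳ ts us vs gs (bags us (proj₂ (∧-true e)))) (sym (bagEq≡sameBag vs ts))))
  app-right (app _ _) (var _) e = refl
  app-right (app _ _) (lam _) e = refl
  app-right (app _ _) (inl _) e = refl
  app-right (app _ _) (inr _) e = refl

mutual
  regular : ∀ t → Regular t
  regular (var i) = regular-head var-head (ℕ-regular i)
  regular (lam s) = regular-head lam-head (regular s)
  regular (inl s) = regular-head inl-head (regular s)
  regular (inr s) = regular-head inr-head (regular s)
  regular (app s ts) = regular-app s ts (regular s) (regularAll ts)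

  regularAll : ∀ ts → All Regular ts
  regularAll [] = []
  regularAll (t ∷ ts) = regular t ∷ regularAll ts

==-sym : ∀ s t → (s == t) ≡ (t == s)
==-sym s t = reg-sym (regular s) t

==-substˡ : ∀ s t z → (s == t) ≡ true → (s == z) ≡ (t == z)
==-substˡ s t z e = sym (reg-left (regular s) t z e)

==-substʳ : ∀ s t z → (s == t) ≡ true → (z == s) ≡ (z == t)
==-substʳ s t z e = sym (reg-right (regular s) t z e)

==-trans : ∀ {s t u} → (s == t) ≡ true → (t == u) ≡ true → (s == u) ≡ true
==-trans {s} {t} {u} e1 e2 = trans (==-substˡ s t u e1) e2

count-↭ : ∀ z {xs ys} → xs ↭ ys → count z xs ≡ count z ys
count-↭ z p = ∑-↭ _ p

count-== : ∀ s t xs → (s == t) ≡ true → count s xs ≡ count t xs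
count-== s t xs e = ∑-cong (λ y → cong 𝟙 (==-substʳ s t y e)) xs

-- Unfolding the
-- factorials of Defs' grouped formula n!·m(t)ⁿ gives exactly this.
mProd : List Term → ℕ
mProd [] = 1
mProd (t ∷ ts) = m t * suc (count t ts) * mProd ts

MultRespects : Term → Set
MultRespects x = ∀ y → (x == y) ≡ true → m x ≡ m y

MultRespects-== : ∀ {x y} → MultRespects x → (x == y) ≡ true → MultRespects y
MultRespects-== {x} {y} h e z e2 = trans (sym (h y e)) (h z (trans (==-substˡ x y z e) e2))

mProd-↭ : ∀ {xs ys} → All MultRespects xs → xs ↭ ys → mProd xs ≡ mProd ys
mProd-↭ a ↭r = refl
mProd-↭ {x ∷ xs} (_ ∷ a) (↭p x p) = cong₂ (λ c f → m x * suc c * f) (count-↭ x p) (mProd-↭ a p)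
mProd-↭ {x ∷ y ∷ xs} {y ∷ x ∷ ys} (ax ∷ ay ∷ a) (↭s x y p) with x == y in q
... | true rewrite sym (==-sym x y) | q | sym (ax y q) | count-↭ x p | count-↭ y p | mProd-↭ a p =
  cong₂ (λ c d → m x * suc (suc c) * (m x * suc d * mProd ys)) (count-== x y ys q) (sym (count-== x y ys q))
... | false rewrite sym (==-sym x y) | q | count-↭ x p | count-↭ y p | mProd-↭ a p = swap-factors (m x) (m y) _ _ _
  where
  swap-factors : ∀ a b c₁ c₂ f → a * suc c₁ * (b * suc c₂ * f) ≡ b * suc c₂ * (a * suc c₁ * f)
  swap-factors = solve-∀
mProd-↭ a (↭t p q) = trans (mProd-↭ a p) (mProd-↭ (All-resp-↭ p a) q)

mProd-sameBag : ∀ ts us → All MultRespects ts → sameBag ts us ≡ true → mProd ts ≡ mProd us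
mProd-sameBag [] [] _ _ = refl
mProd-sameBag [] (_ ∷ _) _ ()
mProd-sameBag (t ∷ ts) us (a ∷ as) e with remove′ t us in q
... | nothing = ⊥-elim (false≢true e)
... | just r with TermBags.remove′-just t us q
...   | u , tu , p =
  trans (cong₂ (λ c f → m t * suc c * f) (trans (TermBags.sameBag⇒count ts r (regularAll ts) e t) (count-== t u r tu)) (mProd-sameBag ts r as e))
  (trans (cong (λ k → k * suc (count u r) * mProd r) (a u tu))
   (mProd-↭ (All-resp-↭ p (TermBags.All-sameBag MultRespects (λ {x} {y} → MultRespects-== {x} {y}) (t ∷ ts) us e' (a ∷ as))) (↭-sym p)))
  where
  e' : sameBag (t ∷ ts) us ≡ true
  e' rewrite q = e

groupSize : Term → List (Term × ℕ × ℕ) → ℕ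
groupSize z [] = 0
groupSize z ((r , mr , n) ∷ gs) = if z == r then n else groupSize z gs

groupSize-insert : ∀ t k gs z → groupSize z (insertG (t , k) gs) ≡ 𝟙 (t == z) + groupSize z gs
groupSize-insert t k [] z rewrite ==-sym t z with z == t
... | true = refl
... | false = refl
groupSize-insert t k ((r , mr , n) ∷ gs) z with t == r in q1
... | true with z == r in q2
...   | true = cong (λ b → 𝟙 b + n) (sym (trans (==-sym t z) (trans (==-substʳ t r z q1) q2)))
...   | false = cong (λ b → 𝟙 b + groupSize z gs) (sym (trans (==-sym t z) (trans (==-substʳ t r z q1) q2)))
groupSize-insert t k ((r , mr , n) ∷ gs) z | false with z == r in q2
...   | true = cong (λ b → 𝟙 b + n) (sym (trans (==-substʳ z r t q2) q1))
...   | false = groupSize-insert t k gs z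

GroupMult : Term × ℕ × ℕ → Set
GroupMult (r , mr , n) = mr ≡ m r

GroupMult-insert : ∀ t gs → All GroupMult gs → All GroupMult (insertG (t , m t) gs)
GroupMult-insert t [] _ = refl ∷ []
GroupMult-insert t ((r , mr , n) ∷ gs) (h ∷ hs) with t == r
... | true = h ∷ hs
... | false = h ∷ GroupMult-insert t gs hs

-- Inserting t multiplies the product by m(t)·(1 + size of t's group),
-- since (n+1)!·m^{n+1} = m·(n+1)·n!·mⁿ.
prodG-insert : ∀ t gs → All GroupMult gs → MultRespects t → prodG (insertG (t , m t) gs) ≡ m t * suc (groupSize t gs) * prodG gs
prodG-insert t [] _ _ = new-group (m t)
  where
  new-group : ∀ a → (1 * (a * 1)) * 1 ≡ a * 1 * 1
  new-group = solve-∀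
prodG-insert t ((r , mr , n) ∷ gs) (h ∷ hs) mt with t == r in q
... | true rewrite h | sym (mt r q) = grow-group n (m t) (n !) (m t ^ n) (prodG gs)
  where
  grow-group : ∀ n a f x p → ((suc n * f) * (a * x)) * p ≡ a * suc n * ((f * x) * p)
  grow-group = solve-∀
... | false rewrite prodG-insert t gs hs mt = skip-group (m t) (suc (groupSize t gs)) (prodG gs) (n ! * mr ^ n)
  where
  skip-group : ∀ a b p x → x * (a * b * p) ≡ a * b * (x * p)
  skip-group = solve-∀

grouping-invariant : ∀ ts → All MultRespects ts →
  All GroupMult (groupG (annotate ts)) × (∀ z → groupSize z (groupG (annotate ts)) ≡ count z ts) × prodG (groupG (annotate ts)) ≡ mProd ts
grouping-invariant [] _ = [] , (λ z → refl) , refl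
grouping-invariant (t ∷ ts) (a ∷ as) with grouping-invariant ts as
... | g1 , g2 , g3 = GroupMult-insert t _ g1 , (λ z → trans (groupSize-insert t (m t) (groupG (annotate ts)) z) (cong (𝟙 (t == z) +_) (g2 z))) ,
      trans (prodG-insert t _ g1 a) (cong₂ (λ c f → m t * suc c * f) (g2 t) g3)

mBag≡mProd-All : ∀ ts → All MultRespects ts → mBag ts ≡ mProd ts
mBag≡mProd-All ts a = proj₂ (proj₂ (grouping-invariant ts a))

mBag-sameBag : ∀ ts us → All MultRespects ts → sameBag ts us ≡ true → mBag ts ≡ mBag us
mBag-sameBag ts us a e = trans (mBag≡mProd-All ts a) (trans (mProd-sameBag ts us a e)
  (sym (mBag≡mProd-All us (TermBags.All-sameBag MultRespects (λ {x} {y} → MultRespects-== {x} {y}) ts us e a))))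

mutual
  m-== : ∀ t → MultRespects t
  m-== (var i) y e with head-payload var-head y e
  ... | _ , refl = refl
  m-== (lam s) y e with head-payload lam-head y e
  ... | b , refl = m-== s b e
  m-== (inl s) y e with head-payload inl-head y e
  ... | b , refl = m-== s b e
  m-== (inr s) y e with head-payload inr-head y e
  ... | b , refl = m-== s b e
  m-== (app s ts) (app s' us) e = cong₂ _*_ (m-== s s' (proj₁ (∧-true e)))
     (mBag-sameBag ts us (m-==All ts) (trans (sym (bagEq≡sameBag ts us)) (proj₂ (∧-true e))))

  m-==All : ∀ ts → All MultRespects ts
  m-==All [] = []
  m-==All (t ∷ ts) = m-== t ∷ m-==All ts

mBag≡mProd : ∀ ts → mBag ts ≡ mProd ts
mBag≡mProd ts = mBag≡mProd-All ts (m-==All ts)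

record _≃_ (xs ys : List Term) : Set where
  constructor mk≃
  field ap≃ : ∀ z → count z xs ≡ count z ys
open _≃_ public

≃-refl : ∀ {xs} → xs ≃ xs
≃-refl = mk≃ λ z → refl

≃-sym : ∀ {xs ys} → xs ≃ ys → ys ≃ xs
≃-sym e = mk≃ λ z → sym (ap≃ e z)

≃-trans : ∀ {xs ys zs} → xs ≃ ys → ys ≃ zs → xs ≃ zs
≃-trans e f = mk≃ λ z → trans (ap≃ e z) (ap≃ f z)

≃→sameBag : ∀ xs ys → xs ≃ ys → sameBag xs ys ≡ true
≃→sameBag xs ys e = TermBags.count⇒sameBag xs ys (regularAll xs) (ap≃ e)

sameBag→≃ : ∀ xs ys → sameBag xs ys ≡ true → xs ≃ ys
sameBag→≃ xs ys e = mk≃ (TermBags.sameBag⇒count xs ys (regularAll xs) e)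

≃→bag : ∀ xs ys → xs ≃ ys → bagEq xs ys ≡ true
≃→bag xs ys e = trans (bagEq≡sameBag xs ys) (≃→sameBag xs ys e)

bag→≃ : ∀ xs ys → bagEq xs ys ≡ true → xs ≃ ys
bag→≃ xs ys e = sameBag→≃ xs ys (trans (sym (bagEq≡sameBag xs ys)) e)

bagEq-cong : ∀ {xs xs' ys ys'} → xs ≃ xs' → ys ≃ ys' → bagEq xs ys ≡ bagEq xs' ys'
bagEq-cong {xs} {xs'} {ys} {ys'} e f = bool-ext
  (λ h → ≃→bag xs' ys' (≃-trans (≃-sym e) (≃-trans (bag→≃ xs ys h) f)))
  (λ h → ≃→bag xs ys (≃-trans e (≃-trans (bag→≃ xs' ys' h) (≃-sym f))))

count-self : ∀ t xs → count t (t ∷ xs) ≡ suc (count t xs)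
count-self t xs rewrite ==-refl t = refl

count-++ : ∀ z xs ys → count z (xs ++ ys) ≡ count z xs + count z ys
count-++ z xs ys = ∑-++ _ xs ys

count-∈ : ∀ a L → a ∈ L → 0 < count a L
count-∈ a L a∈L = ≤-trans (≤-reflexive (cong 𝟙 (sym (==-refl a)))) (∑-≥ (λ y → 𝟙 (y == a)) a∈L)

∷-≃ : ∀ u {l l'} → l ≃ l' → (u ∷ l) ≃ (u ∷ l')
∷-≃ u e = mk≃ λ z → cong (𝟙 (u == z) +_) (ap≃ e z)

∷-== : ∀ {u u'} l → (u == u') ≡ true → (u ∷ l) ≃ (u' ∷ l)
∷-== {u} {u'} l e = mk≃ λ z → cong (λ b → 𝟙 b + count z l) (==-substˡ u u' z e)

swap-≃ : ∀ x y l → (x ∷ y ∷ l) ≃ (y ∷ x ∷ l)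
swap-≃ x y l = mk≃ λ z → trans (sym (+-assoc (𝟙 (x == z)) _ _)) (trans (cong (_+ count z l) (+-comm (𝟙 (x == z)) _)) (+-assoc (𝟙 (y == z)) _ _))

++-≃ : ∀ {a a' b b'} → a ≃ a' → b ≃ b' → (a ++ b) ≃ (a' ++ b')
++-≃ {a} {a'} {b} {b'} e f = mk≃ λ z → trans (count-++ z a b) (trans (cong₂ _+_ (ap≃ e z) (ap≃ f z)) (sym (count-++ z a' b')))

↭→≃ : ∀ {xs ys} → xs ↭ ys → xs ≃ ys
↭→≃ p = mk≃ λ z → count-↭ z p

≃-[] : ∀ {ys} → [] ≃ ys → ys ≡ []
≃-[] {[]} e = refl
≃-[] {y ∷ ys} e with trans (ap≃ e y) (count-self y ys)
... | ()

remove′-some : ∀ t us → 0 < count t us → Σ (List Term) (λ r → remove′ t us ≡ just r)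
remove′-some t us h with remove′ t us in q
... | just r = r , refl
... | nothing with TermBags.remove′-nothing t us (regular t) q
...   | e = ⊥-elim (<-irrefl (sym e) h)

count-remove′ : ∀ t us {r} → remove′ t us ≡ just r → ∀ z → count z us ≡ 𝟙 (t == z) + count z r
count-remove′ t us {r} q z with TermBags.remove′-just t us q
... | u , tu , p = trans (count-↭ z p) (cong (λ b → 𝟙 b + count z r) (sym (==-substˡ t u z tu)))

remove′-≃ : ∀ t us {r} → remove′ t us ≡ just r → us ≃ (t ∷ r)
remove′-≃ t us q = mk≃ (count-remove′ t us q)

remove→remove′ : ∀ d c {c2} → remove d c ≡ just c2 → remove′ d c ≡ just c2
remove→remove′ d c q = trans (sym (remove≡remove′ d c)) q

remove′→remove : ∀ d c {c2} → remove′ d c ≡ just c2 → remove d c ≡ just c2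
remove′→remove d c q = trans (remove≡remove′ d c) q

remove-≃ : ∀ u A {A'} → remove u A ≡ just A' → A ≃ (u ∷ A')
remove-≃ u A q = remove′-≃ u A (remove→remove′ u A q)

count-remove : ∀ u A {A'} → remove u A ≡ just A' → count u A ≡ suc (count u A')
count-remove u A {A'} q = trans (ap≃ (remove-≃ u A q) u) (cong (λ b → 𝟙 b + count u A') (==-refl u))

count-remove-nothing : ∀ u A → remove u A ≡ nothing → count u A ≡ 0
count-remove-nothing u A q = TermBags.remove′-nothing u A (regular u) (trans (sym (remove≡remove′ u A)) q)

remove-== : ∀ a a' b → (a == a') ≡ true → remove a b ≡ remove a' b
remove-== a a' [] e = refl
remove-== a a' (u ∷ us) e rewrite ==-substˡ a a' u e | remove-== a a' us e = refl

Respects== : (Term → ℕ) → Set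
Respects== R = ∀ a a' → (a == a') ≡ true → R a ≡ R a'

∑-≃ : ∀ (R : Term → ℕ) → Respects== R → ∀ L L' → L ≃ L' → ∑ R L ≡ ∑ R L'
∑-≃ R rr [] L' e rewrite ≃-[] {L'} e = refl
∑-≃ R rr (a ∷ L) L' e with remove′-some a L' (subst (0 <_) (trans (sym (count-self a L)) (ap≃ e a)) (s≤s z≤n))
... | r , q with TermBags.remove′-just a L' q
...   | a' , aa' , p =
  trans (cong₂ _+_ (rr a a' aa') (∑-≃ R rr L r (mk≃ λ z → +-cancelˡ-≡ (𝟙 (a == z)) _ _ (trans (ap≃ e z) (count-remove′ a L' q z)))))
        (sym (∑-↭ R p))

sameBag-length : ∀ xs ys → sameBag xs ys ≡ true → length xs ≡ length ys
sameBag-length [] [] e = refl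
sameBag-length [] (_ ∷ _) ()
sameBag-length (t ∷ ts) ys e with remove′ t ys in q
... | nothing = ⊥-elim (false≢true e)
... | just r with TermBags.remove′-just t ys q
...   | u , _ , p = trans (cong suc (sameBag-length ts r e)) (sym (↭-length p))

≃-len : ∀ {xs ys} → xs ≃ ys → length xs ≡ length ys
≃-len {xs} {ys} e = sameBag-length xs ys (≃→sameBag xs ys e)

singleton-≃ : ∀ u u' → (u ∷ []) ≃ (u' ∷ []) → (u' == u) ≡ true
singleton-≃ u u' e with u' == u in q | ap≃ e u
... | true | _ = refl
... | false | h rewrite ==-refl u with h
...   | ()

-- Shifting free indices (used under binders) is injective on indices, so it
-- preserves ==, bag equality, counts and multiplicities.

shiftIndex : ℕ → ℕ → ℕ
shiftIndex c i = if i <ᵇ c then i else suc i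

shift-var : ∀ c i → shift c (var i) ≡ var (shiftIndex c i)
shift-var c i with i <ᵇ c
... | true = refl
... | false = refl

<ᵇ-true⇒< : ∀ a c → (a <ᵇ c) ≡ true → a < c
<ᵇ-true⇒< a c e = <ᵇ⇒< a c (Equivalence.from T-≡ e)

<ᵇ-false⇒≥ : ∀ a c → (a <ᵇ c) ≡ false → c ≤ a
<ᵇ-false⇒≥ a c e = ≮⇒≥ (λ a<c → subst T e (<⇒<ᵇ a<c))

below≢above : ∀ {a b c} → a < c → c ≤ b → a ≢ suc b
below≢above a<c c≤b refl = <-irrefl refl (<-≤-trans a<c (≤-trans c≤b (n≤1+n _)))

shiftIndex-injective : ∀ c i j → shiftIndex c i ≡ shiftIndex c j → i ≡ j
shiftIndex-injective c i j e with i <ᵇ c in p | j <ᵇ c in q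
... | true | true = e
... | false | false = suc-injective e
... | true | false = ⊥-elim (below≢above (<ᵇ-true⇒< i c p) (<ᵇ-false⇒≥ j c q) e)
... | false | true = ⊥-elim (below≢above (<ᵇ-true⇒< j c q) (<ᵇ-false⇒≥ i c p) (sym e))

mutual
  shift-== : ∀ c s t → (shift c s == shift c t) ≡ (s == t)
  shift-== c (var i) (var j) rewrite shift-var c i | shift-var c j =
    bool-ext (λ h → ≡⇒true (shiftIndex-injective c i j (≡ᵇ-true⇒≡ _ _ h)))
             (λ h → ≡⇒true (cong (shiftIndex c) (≡ᵇ-true⇒≡ i j h)))
    where
    ≡⇒true : ∀ {a b} → a ≡ b → (a ≡ᵇ b) ≡ true
    ≡⇒true {a} refl = ≡ᵇ-refl a
  shift-== c (lam s) (lam t) = shift-== (suc c) s t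
  shift-== c (inl s) (inl t) = shift-== c s t
  shift-== c (inr s) (inr t) = shift-== c s t
  shift-== c (app s ts) (app t us) = cong₂ _∧_ (shift-== c s t) (shift-bagEq c ts us)
  shift-== c (var i) (lam t) rewrite shift-var c i = refl
  shift-== c (var i) (app t us) rewrite shift-var c i = refl
  shift-== c (var i) (inl t) rewrite shift-var c i = refl
  shift-== c (var i) (inr t) rewrite shift-var c i = refl
  shift-== c (lam s) (var j) rewrite shift-var c j = refl
  shift-== c (lam s) (app t us) = refl
  shift-== c (lam s) (inl t) = refl
  shift-== c (lam s) (inr t) = refl
  shift-== c (app s ts) (var j) rewrite shift-var c j = refl
  shift-== c (app s ts) (lam t) = refl
  shift-== c (app s ts) (inl t) = refl
  shift-== c (app s ts) (inr t) = refl
  shift-== c (inl s) (var j) rewrite shift-var c j = refl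
  shift-== c (inl s) (lam t) = refl
  shift-== c (inl s) (app t us) = refl
  shift-== c (inl s) (inr t) = refl
  shift-== c (inr s) (var j) rewrite shift-var c j = refl
  shift-== c (inr s) (lam t) = refl
  shift-== c (inr s) (app t us) = refl
  shift-== c (inr s) (inl t) = refl

  shift-bagEq : ∀ c ts us → bagEq (shiftL c ts) (shiftL c us) ≡ bagEq ts us
  shift-bagEq c [] [] = refl
  shift-bagEq c [] (_ ∷ _) = refl
  shift-bagEq c (t ∷ ts) us rewrite shift-remove c t us with remove t us
  ... | just r = shift-bagEq c ts r
  ... | nothing = refl

  shift-remove : ∀ c t us → remove (shift c t) (shiftL c us) ≡ Maybe.map (shiftL c) (remove t us)
  shift-remove c t [] = refl
  shift-remove c t (u ∷ us) rewrite shift-== c t u with t == u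
  ... | true = refl
  ... | false rewrite shift-remove c t us with remove t us
  ...   | just _ = refl
  ...   | nothing = refl

count-shift : ∀ c t us → count (shift c t) (shiftL c us) ≡ count t us
count-shift c t [] = refl
count-shift c t (u ∷ us) = cong₂ _+_ (cong 𝟙 (shift-== c u t)) (count-shift c t us)

mutual
  m-shift : ∀ c s → m (shift c s) ≡ m s
  m-shift c (var i) rewrite shift-var c i = refl
  m-shift c (lam s) = m-shift (suc c) s
  m-shift c (inl s) = m-shift c s
  m-shift c (inr s) = m-shift c s
  m-shift c (app s ts) = cong₂ _*_ (m-shift c s) (trans (mBag≡mProd (shiftL c ts)) (trans (mProd-shift c ts) (sym (mBag≡mProd ts))))

  mProd-shift : ∀ c ts → mProd (shiftL c ts) ≡ mProd ts
  mProd-shift c [] = refl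
  mProd-shift c (t ∷ ts) rewrite m-shift c t | count-shift c t ts | mProd-shift c ts = refl

mBag-shift : ∀ c ts → mBag (shiftL c ts) ≡ mBag ts
mBag-shift c ts = trans (mBag≡mProd (shiftL c ts)) (trans (mProd-shift c ts) (sym (mBag≡mProd ts)))

≃-shift : ∀ c us us' → us ≃ us' → shiftL c us ≃ shiftL c us'
≃-shift c us us' e = bag→≃ (shiftL c us) (shiftL c us') (trans (shift-bagEq c us us') (≃→bag us us' e))

≃-unshift : ∀ us us' → shiftL 0 us ≃ shiftL 0 us' → us ≃ us'
≃-unshift us us' e = bag→≃ us us' (trans (sym (shift-bagEq 0 us us')) (≃→bag _ _ e))

assignments-cons : {A : Set} (k : ℕ) (u : A) (us : List A) (H : Vec (List A) k → ℕ) →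
  ∑ H (assignments k (u ∷ us)) ≡ ∑ (λ v → ∑Fin k (λ i → H (updateAt v i (u ∷_)))) (assignments k us)
assignments-cons k u us H = trans (∑-concatMap H _ (assignments k us))
  (∑-cong (λ v → trans (∑-map H (λ i → updateAt v i (u ∷_)) (allFin k)) (∑-tabulate _ k id)) (assignments k us))

onPair : {A : Set} → (List A → List A → ℕ) → Vec (List A) 2 → ℕ
onPair f (a ∷ b ∷ []) = f a b

assignments-split : {A : Set} (k : ℕ) (us : List A) (H : Vec (List A) (suc k) → ℕ) →
  ∑ H (assignments (suc k) us) ≡ ∑ (onPair (λ q0 q1 → ∑ (λ w → H (q0 ∷ w)) (assignments k q1))) (assignments 2 us)
assignments-split k [] H = sym (+-identityʳ _)
assignments-split {A} k (u ∷ us) H =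
  trans (assignments-cons (suc k) u us H)
  (trans (assignments-split k us G)
  (sym (trans (assignments-cons 2 u us K) (∑-cong place-u (assignments 2 us)))))
  where
  G : Vec (List A) (suc k) → ℕ
  G v = ∑Fin (suc k) (λ i → H (updateAt v i (u ∷_)))
  K : Vec (List A) 2 → ℕ
  K = onPair (λ q0 q1 → ∑ (λ w → H (q0 ∷ w)) (assignments k q1))
  place-u : ∀ q → ∑Fin 2 (λ i → K (updateAt q i (u ∷_))) ≡ onPair (λ q0 q1 → ∑ (λ w → G (q0 ∷ w)) (assignments k q1)) q
  place-u (q0 ∷ q1 ∷ []) = trans (cong (∑ (λ w → H ((u ∷ q0) ∷ w)) (assignments k q1) +_)
      (trans (+-identityʳ _) (assignments-cons k u q1 (λ w → H (q0 ∷ w)))))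
      (sym (∑-+ _ _ (assignments k q1)))

Pointwise≃ : ∀ {k} → Vec (List Term) k → Vec (List Term) k → Set
Pointwise≃ [] [] = ⊤
Pointwise≃ (a ∷ v) (b ∷ w) = a ≃ b × Pointwise≃ v w

Pointwise≃-refl : ∀ {k} (v : Vec (List Term) k) → Pointwise≃ v v
Pointwise≃-refl [] = tt
Pointwise≃-refl (a ∷ v) = ≃-refl , Pointwise≃-refl v

updateAt-≃ : ∀ {k} u (v v' : Vec (List Term) k) i → Pointwise≃ v v' → Pointwise≃ (updateAt v i (u ∷_)) (updateAt v' i (u ∷_))
updateAt-≃ u (a ∷ v) (b ∷ w) zero (e , f) = ∷-≃ u e , f
updateAt-≃ u (a ∷ v) (b ∷ w) (suc i) (e , f) = e , updateAt-≃ u v w i f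

updateAt-== : ∀ {k} {u u'} (v : Vec (List Term) k) i → (u == u') ≡ true → Pointwise≃ (updateAt v i (u ∷_)) (updateAt v i (u' ∷_))
updateAt-== (a ∷ v) zero e = ∷-== a e , Pointwise≃-refl v
updateAt-== (a ∷ v) (suc i) e = ≃-refl , updateAt-== v i e

updateAt-comm : ∀ {k} x y (v : Vec (List Term) k) i j →
  Pointwise≃ (updateAt (updateAt v j (y ∷_)) i (x ∷_)) (updateAt (updateAt v i (x ∷_)) j (y ∷_))
updateAt-comm x y (a ∷ v) zero zero = swap-≃ x y a , Pointwise≃-refl v
updateAt-comm x y (a ∷ v) zero (suc j) = ≃-refl , Pointwise≃-refl _
updateAt-comm x y (a ∷ v) (suc i) zero = ≃-refl , Pointwise≃-refl _
updateAt-comm x y (a ∷ v) (suc i) (suc j) = ≃-refl , updateAt-comm x y v i j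

Respects≃ : ∀ {k} → (Vec (List Term) k → ℕ) → Set
Respects≃ H = ∀ v v' → Pointwise≃ v v' → H v ≡ H v'

Respects≃-cons : ∀ {k} u (H : Vec (List Term) k → ℕ) → Respects≃ H → Respects≃ (λ v → ∑Fin k (λ i → H (updateAt v i (u ∷_))))
Respects≃-cons {k} u H H-resp v v' e = ∑Fin-cong k (λ i → H-resp _ _ (updateAt-≃ u v v' i e))

assignments-↭ : ∀ k (H : Vec (List Term) k → ℕ) → Respects≃ H → ∀ {xs ys} → xs ↭ ys →
  ∑ H (assignments k xs) ≡ ∑ H (assignments k ys)
assignments-↭ k H H-resp ↭r = refl
assignments-↭ k H H-resp (↭p {xs} {ys} x p) =
  trans (assignments-cons k x xs H) (trans (assignments-↭ k _ (Respects≃-cons x H H-resp) p) (sym (assignments-cons k x ys H)))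
assignments-↭ k H H-resp (↭s {xs} {ys} x y p) =
  trans (assignments-cons k x (y ∷ xs) H) (trans (assignments-cons k y xs _)
  (trans (assignments-↭ k G (Respects≃-cons y _ (Respects≃-cons x H H-resp)) p)
  (trans (∑-cong place-both (assignments k ys))
  (sym (trans (assignments-cons k y (x ∷ ys) H) (assignments-cons k x ys _))))))
  where
  G : Vec (List Term) k → ℕ
  G w = ∑Fin k (λ j → ∑Fin k (λ i → H (updateAt (updateAt w j (y ∷_)) i (x ∷_))))
  place-both : ∀ w → G w ≡ ∑Fin k (λ j → ∑Fin k (λ i → H (updateAt (updateAt w j (x ∷_)) i (y ∷_))))
  place-both w = trans (∑Fin-cong k (λ j → ∑Fin-cong k (λ i → H-resp _ _ (updateAt-comm x y w i j))))
                       (∑Fin-swap k (λ j i → H (updateAt (updateAt w i (x ∷_)) j (y ∷_))))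
assignments-↭ k H H-resp (↭t p q) = trans (assignments-↭ k H H-resp p) (assignments-↭ k H H-resp q)

assignments-≃ : ∀ k (H : Vec (List Term) k → ℕ) → Respects≃ H → ∀ us us' → us ≃ us' →
  ∑ H (assignments k us) ≡ ∑ H (assignments k us')
assignments-≃ k H H-resp [] us' e rewrite ≃-[] {us'} e = refl
assignments-≃ k H H-resp (u ∷ us) us' e with remove′-some u us' (subst (0 <_) (trans (sym (count-self u us)) (ap≃ e u)) (s≤s z≤n))
... | r , q with TermBags.remove′-just u us' q
...   | u' , uu' , p =
  trans (assignments-cons k u us H)
  (trans (assignments-≃ k _ (Respects≃-cons u H H-resp) us r (mk≃ λ z → +-cancelˡ-≡ (𝟙 (u == z)) _ _ (trans (ap≃ e z) (count-remove′ u us' q z))))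
  (trans (∑-cong (λ v → ∑Fin-cong k (λ i → H-resp _ _ (updateAt-== v i uu'))) (assignments k r))
  (sym (trans (assignments-↭ k H H-resp p) (assignments-cons k u' r H)))))

splits : List Term → List (Vec (List Term) 2)
splits = assignments 2

IsSplit : List Term → Vec (List Term) 2 → Set
IsSplit us q = us ≃ (lookup q zero ++ lookup q (suc zero))

All-concatMap : {A B : Set} {P : B → Set} {P' : A → Set} (f : A → List B) → (∀ v → P' v → All P (f v)) → ∀ xs → All P' xs → All P (concatMap f xs)
All-concatMap f h [] [] = []
All-concatMap f h (x ∷ xs) (px ∷ pxs) = ++⁺ (h x px) (All-concatMap f h xs pxs)

splits-sound : ∀ us → All (IsSplit us) (splits us)
splits-sound [] = ≃-refl ∷ []
splits-sound (u ∷ us) = All-concatMap _ add-u (splits us) (splits-sound us)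
  where
  add-u : ∀ v → IsSplit us v → All (IsSplit (u ∷ us)) _
  add-u (q0 ∷ q1 ∷ []) e = mk≃ (λ z → cong (𝟙 (u == z) +_) (ap≃ e z)) ∷
    mk≃ (λ z → trans (cong (𝟙 (u == z) +_) (trans (ap≃ e z) (count-++ z q0 q1)))
         (trans (+-leftComm (𝟙 (u == z)) (count z q0) (count z q1)) (sym (count-++ z q0 (u ∷ q1))))) ∷ []

split-∈ : ∀ X Y → (X ∷ Y ∷ []) ∈ splits (X ++ Y)
split-∈ [] [] = here refl
split-∈ [] (u ∷ Y) = ∈-concatMap⁺ _ (Any.map (λ { refl → there (here refl) }) (split-∈ [] Y))
split-∈ (u ∷ X) Y = ∈-concatMap⁺ _ (Any.map (λ { refl → here refl }) (split-∈ X Y))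

onTriple : (List Term → List Term → List Term → ℕ) → Vec (List Term) 3 → ℕ
onTriple g (a ∷ b ∷ c ∷ []) = g a b c

swap₀₁ : Vec (List Term) 3 → Vec (List Term) 3
swap₀₁ (a ∷ b ∷ c ∷ []) = b ∷ a ∷ c ∷ []

assignments-swap₀₁ : ∀ us (H : Vec (List Term) 3 → ℕ) → ∑ H (assignments 3 us) ≡ ∑ (H ∘ swap₀₁) (assignments 3 us)
assignments-swap₀₁ [] H = refl
assignments-swap₀₁ (u ∷ us) H =
  trans (assignments-cons 3 u us H) (trans (assignments-swap₀₁ us G) (trans (∑-cong place-u (assignments 3 us)) (sym (assignments-cons 3 u us (H ∘ swap₀₁)))))
  where
  G : Vec (List Term) 3 → ℕ
  G v = ∑Fin 3 (λ i → H (updateAt v i (u ∷_)))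
  place-u : ∀ v → G (swap₀₁ v) ≡ ∑Fin 3 (λ i → H (swap₀₁ (updateAt v i (u ∷_))))
  place-u (a ∷ b ∷ c ∷ []) = swap-first-two (H ((u ∷ b) ∷ a ∷ c ∷ [])) (H (b ∷ (u ∷ a) ∷ c ∷ [])) (H (b ∷ a ∷ (u ∷ c) ∷ []))
    where
    swap-first-two : ∀ a b c → a + (b + (c + 0)) ≡ b + (a + (c + 0))
    swap-first-two a b c = +-leftComm a b (c + 0)

splits-swap : ∀ us (G : List Term → List Term → List Term → ℕ) →
  ∑ (onPair (λ q0 q1 → ∑ (onPair (λ r0 r1 → G q0 r0 r1)) (splits q1))) (splits us) ≡
  ∑ (onPair (λ q0 q1 → ∑ (onPair (λ r0 r1 → G r0 q0 r1)) (splits q1))) (splits us)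
splits-swap us G = trans (sym (trans (assignments-split 2 us (onTriple G)) (∑-cong (nest G) (splits us))))
  (trans (assignments-swap₀₁ us (onTriple G)) (trans (assignments-split 2 us (onTriple G ∘ swap₀₁)) (∑-cong nest-swapped (splits us))))
  where
  nest : ∀ G' q → onPair (λ q0 q1 → ∑ (λ w → onTriple G' (q0 ∷ w)) (splits q1)) q ≡ onPair (λ q0 q1 → ∑ (onPair (λ r0 r1 → G' q0 r0 r1)) (splits q1)) q
  nest G' (q0 ∷ q1 ∷ []) = ∑-cong (λ { (r0 ∷ r1 ∷ []) → refl }) (splits q1)
  nest-swapped : ∀ q → onPair (λ q0 q1 → ∑ (λ w → (onTriple G ∘ swap₀₁) (q0 ∷ w)) (splits q1)) q ≡ onPair (λ q0 q1 → ∑ (onPair (λ r0 r1 → G r0 q0 r1)) (splits q1)) q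
  nest-swapped (q0 ∷ q1 ∷ []) = ∑-cong (λ { (r0 ∷ r1 ∷ []) → refl }) (splits q1)

countM : Monomial → List Monomial → ℕ
countM b L = ∑ (λ c → 𝟙 (bagEq c b)) L

countM-≃ : ∀ {b b'} → b ≃ b' → ∀ C → countM b C ≡ countM b' C
countM-≃ e C = ∑-cong (λ c → cong 𝟙 (bagEq-cong (≃-refl {c}) e)) C

count-map : ∀ (f : Term → Term) z L → count z (map f L) ≡ ∑ (λ y → 𝟙 (f y == z)) L
count-map f z L = ∑-map _ f L

map-≃ : ∀ {f} → Head _==_ f → ∀ L L' → L ≃ L' → map f L ≃ map f L'
map-≃ {f} h L L' e = mk≃ λ z → trans (count-map f z L)
  (trans (∑-≃ (λ y → 𝟙 (f y == z)) (λ a a' q → cong 𝟙 (==-substˡ (f a) (f a') z (trans (Head.head-== h a a') q))) L L' e)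
         (sym (count-map f z L')))

count-map-head : ∀ {f} → Head _==_ f → ∀ a L → count (f a) (map f L) ≡ count a L
count-map-head {f} h a L = trans (count-map f (f a) L) (∑-cong (λ y → cong 𝟙 (Head.head-== h y a)) L)

count-map-head⁻ : ∀ {f} → Head _==_ f → ∀ z L → 0 < count z (map f L) → Σ Term (λ a → z ≡ f a)
count-map-head⁻ {f} h z L pos with ∑-pos _ L (subst (0 <_) (count-map f z L) pos)
... | y , _ , fy==z = head-payload h z (𝟙-pos _ fy==z)

app-head : Head (λ p q → (proj₁ p == proj₁ q) ∧ bagEq (proj₂ p) (proj₂ q)) (λ p → app (proj₁ p) (proj₂ p))
app-head = record { head-== = λ _ _ → refl ; head-view = view }
  where
  view : ∀ y → Σ (Term × Monomial) (λ p → y ≡ app (proj₁ p) (proj₂ p)) ⊎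
               (∀ p → (app (proj₁ p) (proj₂ p) == y) ≡ false × (y == app (proj₁ p) (proj₂ p)) ≡ false)
  view (app s ts) = inj₁ ((s , ts) , refl)
  view (var _) = inj₂ λ _ → refl , refl
  view (lam _) = inj₂ λ _ → refl , refl
  view (inl _) = inj₂ λ _ → refl , refl
  view (inr _) = inj₂ λ _ → refl , refl

count-∂app : ∀ x s ts us z → count z (∂t x (app s ts) us) ≡
  ∑ (onPair (λ p0 p1 → ∑ (λ a' → ∑ (λ b' → 𝟙 (app a' b' == z)) (∂m x ts p1)) (∂t x s p0))) (splits us)
count-∂app x s ts us z = trans (∑-concatMap _ _ (splits us)) (∑-cong expand (splits us))
  where
  expand : ∀ p → _
  expand (p0 ∷ p1 ∷ []) = trans (∑-concatMap _ _ (∂t x s p0)) (∑-cong (λ a' → ∑-map _ (app a') (∂m x ts p1)) (∂t x s p0))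

count-∂app-app : ∀ x s ts us a b → count (app a b) (∂t x (app s ts) us) ≡
  ∑ (onPair (λ p0 p1 → count a (∂t x s p0) * countM b (∂m x ts p1))) (splits us)
count-∂app-app x s ts us a b = trans (count-∂app x s ts us (app a b)) (∑-cong factor (splits us))
  where
  factor : ∀ p → _
  factor (p0 ∷ p1 ∷ []) = trans (∑-cong (λ a' → trans (∑-cong (λ b' → 𝟙-∧ (a' == a) (bagEq b' b)) (∂m x ts p1))
                                                      (∑-*ˡ (𝟙 (a' == a)) _ (∂m x ts p1))) (∂t x s p0))
                                (∑-*ʳ _ _ (∂t x s p0))

count-∂app-nonapp : ∀ x s ts us z → (∀ a b → (app a b == z) ≡ false) → count z (∂t x (app s ts) us) ≡ 0
count-∂app-nonapp x s ts us z notApp = trans (count-∂app x s ts us z) (∑-zero _ none (splits us))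
  where
  none : ∀ p → _
  none (p0 ∷ p1 ∷ []) = ∑-zero _ (λ a' → ∑-zero _ (λ b' → cong 𝟙 (notApp a' b')) (∂m x ts p1)) (∂t x s p0)

countAfter : Term → Monomial → List Monomial → ℕ
countAfter a b C = maybe (λ r → countM r C) 0 (remove a b)

countAfter-∑ : ∀ a b C → ∑ (λ c → 𝟙 (bagEq (a ∷ c) b)) C ≡ countAfter a b C
countAfter-∑ a b C with remove a b
... | just r = refl
... | nothing = ∑-zero _ (λ _ → refl) C

countAfter-== : ∀ b C → Respects== (λ a → countAfter a b C)
countAfter-== b C a a' e rewrite remove-== a a' b e = refl

countM-∂bag-cons : ∀ x t ts p v b → countM b (∂bag x (t ∷ ts) (p ∷ v)) ≡ ∑ (λ a → countAfter a b (∂bag x ts v)) (∂t x t p)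
countM-∂bag-cons x t ts p v b = trans (∑-concatMap _ _ (∂t x t p))
  (∑-cong (λ a → trans (∑-map _ (a ∷_) (∂bag x ts v)) (countAfter-∑ a b (∂bag x ts v))) (∂t x t p))

countM-∂m : ∀ x ts us b → countM b (∂m x ts us) ≡ ∑ (λ v → countM b (∂bag x ts v)) (assignments (length ts) us)
countM-∂m x ts us b = ∑-concatMap (λ c → 𝟙 (bagEq c b)) (∂bag x ts) (assignments (length ts) us)

mutual
  ∂t-≃ : ∀ s x us us' → us ≃ us' → ∀ a → count a (∂t x s us) ≡ count a (∂t x s us')
  ∂t-≃ (var y) x [] [] e a = refl
  ∂t-≃ (var y) x [] (_ ∷ _) e a with ≃-len e
  ... | ()
  ∂t-≃ (var y) x (_ ∷ _) [] e a with ≃-len e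
  ... | ()
  ∂t-≃ (var y) x (u ∷ []) (u' ∷ []) e a with y ≡ᵇ x
  ... | true = cong (λ b → 𝟙 b + 0) (sym (==-substˡ u' u a (singleton-≃ u u' e)))
  ... | false = refl
  ∂t-≃ (var y) x (u ∷ []) (_ ∷ _ ∷ _) e a with ≃-len e
  ... | ()
  ∂t-≃ (var y) x (_ ∷ _ ∷ _) (_ ∷ []) e a with ≃-len e
  ... | ()
  ∂t-≃ (var y) x (_ ∷ _ ∷ _) (_ ∷ _ ∷ _) e a = refl
  ∂t-≃ (lam s) x us us' e = ap≃ (map-≃ lam-head (∂t (suc x) s (shiftL 0 us)) (∂t (suc x) s (shiftL 0 us')) (mk≃ (∂t-≃ s (suc x) (shiftL 0 us) (shiftL 0 us') (≃-shift 0 us us' e))))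
  ∂t-≃ (inl s) x us us' e = ap≃ (map-≃ inl-head (∂t x s us) (∂t x s us') (mk≃ (∂t-≃ s x us us' e)))
  ∂t-≃ (inr s) x us us' e = ap≃ (map-≃ inr-head (∂t x s us) (∂t x s us') (mk≃ (∂t-≃ s x us us' e)))
  ∂t-≃ (app s ts) x us us' e z with Head.head-view app-head z
  ... | inj₁ ((a , b) , refl) =
    trans (count-∂app-app x s ts us a b) (trans (assignments-≃ 2 _ factors us us' e) (sym (count-∂app-app x s ts us' a b)))
    where
    factors : Respects≃ (onPair (λ p0 p1 → count a (∂t x s p0) * countM b (∂m x ts p1)))
    factors (p0 ∷ p1 ∷ []) (q0 ∷ q1 ∷ []) (e0 , e1 , _) = cong₂ _*_ (∂t-≃ s x p0 q0 e0 a) (∂m-≃ ts x p1 q1 e1 b)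
  ... | inj₂ other = trans (count-∂app-nonapp x s ts us z notApp) (sym (count-∂app-nonapp x s ts us' z notApp))
    where
    notApp : ∀ a b → (app a b == z) ≡ false
    notApp a b = proj₁ (other (a , b))

  ∂m-≃ : ∀ ts x us us' → us ≃ us' → ∀ b → countM b (∂m x ts us) ≡ countM b (∂m x ts us')
  ∂m-≃ ts x us us' e b = trans (countM-∂m x ts us b) (trans (assignments-≃ (length ts) (λ v → countM b (∂bag x ts v))
      (λ v v' ev → ∂bag-≃ ts x v v' ev b) us us' e) (sym (countM-∂m x ts us' b)))

  ∂bag-≃ : ∀ ts x (v v' : Vec (List Term) (length ts)) → Pointwise≃ v v' → ∀ b → countM b (∂bag x ts v) ≡ countM b (∂bag x ts v')
  ∂bag-≃ [] x [] [] _ b = refl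
  ∂bag-≃ (t ∷ ts) x (p ∷ v) (p' ∷ v') (e , ev) b =
    trans (countM-∂bag-cons x t ts p v b) (trans (∑-cong rest (∂t x t p))
     (trans (∑-≃ (λ a → countAfter a b (∂bag x ts v')) (countAfter-== b (∂bag x ts v')) (∂t x t p) (∂t x t p') (mk≃ (λ a → ∂t-≃ t x p p' e a)))
     (sym (countM-∂bag-cons x t ts p' v' b))))
    where
    rest : ∀ a → countAfter a b (∂bag x ts v) ≡ countAfter a b (∂bag x ts v')
    rest a with remove a b
    ... | just r = ∂bag-≃ ts x v v' ev r
    ... | nothing = refl

countM-∂m-cons : ∀ x t ts us b → countM b (∂m x (t ∷ ts) us) ≡ ∑ (onPair (λ q0 q1 → ∑ (λ a → countAfter a b (∂m x ts q1)) (∂t x t q0))) (splits us)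
countM-∂m-cons x t ts us b = trans (countM-∂m x (t ∷ ts) us b) (trans (assignments-split (length ts) us (λ v → countM b (∂bag x (t ∷ ts) v))) (∑-cong regroup (splits us)))
  where
  collect : ∀ q1 a → ∑ (λ w → countAfter a b (∂bag x ts w)) (assignments (length ts) q1) ≡ countAfter a b (∂m x ts q1)
  collect q1 a with remove a b
  ... | just r = sym (countM-∂m x ts q1 r)
  ... | nothing = ∑-zero _ (λ _ → refl) (assignments (length ts) q1)
  regroup : ∀ q → _
  regroup (q0 ∷ q1 ∷ []) = trans (∑-cong (λ w → countM-∂bag-cons x t ts q0 w b) (assignments (length ts) q1))
    (trans (∑-swap (λ w a → countAfter a b (∂bag x ts w)) (assignments (length ts) q1) (∂t x t q0))
     (∑-cong (collect q1) (∂t x t q0)))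

countAfter₂ : Term → Term → Monomial → List Monomial → ℕ
countAfter₂ a a' b C = maybe (λ r → countAfter a' r C) 0 (remove a b)

countAfter₂-∑ : ∀ a a' b C → ∑ (λ c → 𝟙 (bagEq (a ∷ a' ∷ c) b)) C ≡ countAfter₂ a a' b C
countAfter₂-∑ a a' b C with remove a b
... | just r = countAfter-∑ a' r C
... | nothing = ∑-zero _ (λ _ → refl) C

countAfter₂-comm : ∀ a a' b C → countAfter₂ a a' b C ≡ countAfter₂ a' a b C
countAfter₂-comm a a' b C = trans (sym (countAfter₂-∑ a a' b C))
  (trans (∑-cong (λ c → cong 𝟙 (bagEq-cong (swap-≃ a a' c) (≃-refl {b}))) C) (countAfter₂-∑ a' a b C))

twoHeads : ℕ → Term → Term → List Term → Monomial → List Term → List Term → List Term → ℕ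
twoHeads x t1 t2 ts b Q0 Q1 Q2 = ∑ (λ a → ∑ (λ a' → countAfter₂ a a' b (∂m x ts Q2)) (∂t x t2 Q1)) (∂t x t1 Q0)

countAfter-∂m-cons : ∀ x a t2 ts b q1 → countAfter a b (∂m x (t2 ∷ ts) q1) ≡ ∑ (onPair (λ r0 r1 → ∑ (λ a' → countAfter₂ a a' b (∂m x ts r1)) (∂t x t2 r0))) (splits q1)
countAfter-∂m-cons x a t2 ts b q1 with remove a b
... | just r = countM-∂m-cons x t2 ts q1 r
... | nothing = sym (∑-zero _ (λ { (r0 ∷ r1 ∷ []) → ∑-zero _ (λ _ → refl) (∂t x t2 r0) }) (splits q1))

countM-∂m-cons₂ : ∀ x t1 t2 ts us b → countM b (∂m x (t1 ∷ t2 ∷ ts) us) ≡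
  ∑ (onPair (λ q0 q1 → ∑ (onPair (λ r0 r1 → twoHeads x t1 t2 ts b q0 r0 r1)) (splits q1))) (splits us)
countM-∂m-cons₂ x t1 t2 ts us b = trans (countM-∂m-cons x t1 (t2 ∷ ts) us b) (∑-cong regroup (splits us))
  where
  regroup : ∀ q → _
  regroup (q0 ∷ q1 ∷ []) = trans (∑-cong (λ a → countAfter-∂m-cons x a t2 ts b q1) (∂t x t1 q0))
    (trans (∑-swap (λ a r → onPair (λ r0 r1 → ∑ (λ a' → countAfter₂ a a' b (∂m x ts r1)) (∂t x t2 r0)) r) (∂t x t1 q0) (splits q1))
     (∑-cong (λ { (r0 ∷ r1 ∷ []) → refl }) (splits q1)))

countM-∂m-↭ : ∀ {xs ys} → xs ↭ ys → ∀ x us b → countM b (∂m x xs us) ≡ countM b (∂m x ys us)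
countM-∂m-↭ ↭r x us b = refl
countM-∂m-↭ (↭p {xs} {ys} t p) x us b =
  trans (countM-∂m-cons x t xs us b) (trans (∑-cong (λ { (q0 ∷ q1 ∷ []) → ∑-cong (rest q1) (∂t x t q0) }) (splits us)) (sym (countM-∂m-cons x t ys us b)))
  where
  rest : ∀ q1 a → countAfter a b (∂m x xs q1) ≡ countAfter a b (∂m x ys q1)
  rest q1 a with remove a b
  ... | just r = countM-∂m-↭ p x q1 r
  ... | nothing = refl
countM-∂m-↭ (↭s {xs} {ys} t1 t2 p) x us b =
  trans (countM-∂m-cons₂ x t1 t2 xs us b)
  (trans (∑-cong (λ { (q0 ∷ q1 ∷ []) → ∑-cong (exchange q0) (splits q1) }) (splits us))
  (trans (sym (splits-swap us (λ a b' c → twoHeads x t2 t1 ys b a b' c)))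
  (sym (countM-∂m-cons₂ x t2 t1 ys us b))))
  where
  rest : ∀ r1 a a' → countAfter₂ a a' b (∂m x xs r1) ≡ countAfter₂ a a' b (∂m x ys r1)
  rest r1 a a' with remove a b
  ... | nothing = refl
  ... | just r with remove a' r
  ...   | nothing = refl
  ...   | just r' = countM-∂m-↭ p x r1 r'
  exchange : ∀ q0 r → onPair (λ r0 r1 → twoHeads x t1 t2 xs b q0 r0 r1) r ≡ onPair (λ r0 r1 → twoHeads x t2 t1 ys b r0 q0 r1) r
  exchange q0 (r0 ∷ r1 ∷ []) =
    trans (∑-cong (λ a → ∑-cong (λ a' → rest r1 a a') (∂t x t2 r0)) (∂t x t1 q0))
    (trans (∑-swap (λ a a' → countAfter₂ a a' b (∂m x ys r1)) (∂t x t1 q0) (∂t x t2 r0))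
     (∑-cong (λ a' → ∑-cong (λ a → countAfter₂-comm a a' b (∂m x ys r1)) (∂t x t1 q0)) (∂t x t2 r0)))
countM-∂m-↭ (↭t p q) x us b = trans (countM-∂m-↭ p x us b) (countM-∂m-↭ q x us b)

mutual
  count-∂t-== : ∀ s s' → (s == s') ≡ true → ∀ x us a → count a (∂t x s us) ≡ count a (∂t x s' us)
  count-∂t-== (var i) (var j) e x us a rewrite ≡ᵇ-true⇒≡ i j e = refl
  count-∂t-== (lam s) (lam s') e x us = ap≃ (map-≃ lam-head (∂t (suc x) s (shiftL 0 us)) (∂t (suc x) s' (shiftL 0 us)) (mk≃ (count-∂t-== s s' e (suc x) (shiftL 0 us))))
  count-∂t-== (inl s) (inl s') e x us = ap≃ (map-≃ inl-head (∂t x s us) (∂t x s' us) (mk≃ (count-∂t-== s s' e x us)))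
  count-∂t-== (inr s) (inr s') e x us = ap≃ (map-≃ inr-head (∂t x s us) (∂t x s' us) (mk≃ (count-∂t-== s s' e x us)))
  count-∂t-== (app s ts) (app s' ts') e x us z with Head.head-view app-head z
  ... | inj₁ ((a , b) , refl) =
    trans (count-∂app-app x s ts us a b) (trans (∑-cong factors (splits us)) (sym (count-∂app-app x s' ts' us a b)))
    where
    factors : ∀ p → _
    factors (p0 ∷ p1 ∷ []) = cong₂ _*_ (count-∂t-== s s' (proj₁ (∧-true e)) x p0 a) (countM-∂m-bagEq ts ts' (proj₂ (∧-true e)) x p1 b)
  ... | inj₂ other = trans (count-∂app-nonapp x s ts us z notApp) (sym (count-∂app-nonapp x s' ts' us z notApp))
    where
    notApp : ∀ a b → (app a b == z) ≡ false
    notApp a b = proj₁ (other (a , b))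

  countM-∂m-bagEq : ∀ ts ts' → bagEq ts ts' ≡ true → ∀ x us b → countM b (∂m x ts us) ≡ countM b (∂m x ts' us)
  countM-∂m-bagEq [] [] e x us b = refl
  countM-∂m-bagEq [] (_ ∷ _) () x us b
  countM-∂m-bagEq (t ∷ ts) ts' e x us b with remove t ts' in q
  ... | nothing = ⊥-elim (false≢true e)
  ... | just r with TermBags.remove′-just t ts' (remove→remove′ t ts' q)
  ...   | t' , tt' , p =
    trans (countM-∂m-cons x t ts us b) (trans (∑-cong replace (splits us)) (trans (sym (countM-∂m-cons x t' r us b)) (countM-∂m-↭ (↭-sym p) x us b)))
    where
    rest : ∀ q1 a → countAfter a b (∂m x ts q1) ≡ countAfter a b (∂m x r q1)
    rest q1 a with remove a b
    ... | just r' = countM-∂m-bagEq ts r e x q1 r'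
    ... | nothing = refl
    replace : ∀ q → _
    replace (q0 ∷ q1 ∷ []) = trans (∑-cong (rest q1) (∂t x t q0))
      (∑-≃ (λ a → countAfter a b (∂m x r q1)) (countAfter-== b (∂m x r q1)) (∂t x t q0) (∂t x t' q0) (mk≃ (λ a → count-∂t-== t t' tt' x q0 a)))

Occurs : ℕ → Term → List Term → Term → Set
Occurs x s us a = 0 < count a (∂t x s us)

OccursM : ℕ → List Term → List Term → Monomial → Set
OccursM x ts us b = 0 < countM b (∂m x ts us)

OccursM-cons : ∀ x t ts q0 q1 a c → Occurs x t q0 a → OccursM x ts q1 c → OccursM x (t ∷ ts) (q0 ++ q1) (a ∷ c)
OccursM-cons x t ts q0 q1 a c occ-a occ-c with ∑-pos _ (∂t x t q0) occ-a
... | a' , a'∈ , a'==a = subst (0 <_) (sym (countM-∂m-cons x t ts (q0 ++ q1) (a ∷ c)))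
   (<-≤-trans (<-≤-trans occ-c (≤-reflexive (sym remove-a'))) (≤-trans (∑-≥ _ a'∈) (∑-≥ _ (split-∈ q0 q1))))
  where
  remove-a' : countAfter a' (a ∷ c) (∂m x ts q1) ≡ countM c (∂m x ts q1)
  remove-a' rewrite 𝟙-pos _ a'==a = refl

OccursM-cons⁻ : ∀ x t ts us b → OccursM x (t ∷ ts) us b →
  Σ (List Term) λ q0 → Σ (List Term) λ q1 → Σ Term λ a → Σ Monomial λ r →
    ((q0 ∷ q1 ∷ []) ∈ splits us) × Occurs x t q0 a × (remove a b ≡ just r) × OccursM x ts q1 r
OccursM-cons⁻ x t ts us b h with ∑-pos _ (splits us) (subst (0 <_) (countM-∂m-cons x t ts us b) h)
... | (q0 ∷ q1 ∷ []) , mq , pq with ∑-pos _ (∂t x t q0) pq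
...   | a , ma , pa with remove a b in qr
...     | just r = q0 , q1 , a , r , mq , count-∈ a _ ma , qr , pa
...     | nothing with pa
...       | ()

OccursM-[] : ∀ x us c → OccursM x [] us c → (us ≡ []) × (c ≡ [])
OccursM-[] x [] [] h = refl , refl
OccursM-[] x [] (_ ∷ _) ()
OccursM-[] x (u ∷ us) c h = ⊥-elim (<-irrefl (sym (cong (countM c ∘ concatMap (∂bag x [])) (no-assignment us))) h)
  where
  no-slot : ∀ (vs : List (Vec (List Term) 0)) → concatMap (λ v → map (λ i → updateAt v i (u ∷_)) (allFin 0)) vs ≡ []
  no-slot [] = refl
  no-slot (_ ∷ vs) = no-slot vs
  no-assignment : ∀ us → assignments 0 (u ∷ us) ≡ []
  no-assignment us = no-slot (assignments 0 us)

OccursM-[]-target : ∀ x ts us → OccursM x ts us [] → ts ≡ []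
OccursM-[]-target x [] us h = refl
OccursM-[]-target x (t ∷ ts) us h with OccursM-cons⁻ x t ts us [] h
... | _ , _ , _ , _ , _ , _ , () , _

remove′-both : ∀ d a c {c2 r} → remove′ d c ≡ just c2 → remove′ a c ≡ just r → (d == a) ≡ false →
  Σ (List Term) λ r2 → (remove′ d r ≡ just r2) × (c2 ≃ (a ∷ r2))
remove′-both d a c {c2} {r} q1 q2 ne with remove′-some d r (subst (0 <_) d-in-r (s≤s z≤n))
  where
  d-in-r : suc (count d c2) ≡ count d r
  d-in-r = +-cancelˡ-≡ (𝟙 (a == d)) _ _ (trans (cong (_+ suc (count d c2)) (cong 𝟙 (trans (==-sym a d) ne)))
          (trans (cong (λ b → 𝟙 b + count d c2) (sym (==-refl d))) (trans (sym (count-remove′ d c q1 d)) (count-remove′ a c q2 d))))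
... | r2 , q3 = r2 , q3 , mk≃ (λ z → +-cancelˡ-≡ (𝟙 (d == z)) _ _
        (trans (sym (count-remove′ d c q1 z)) (trans (count-remove′ a c q2 z)
          (trans (cong (𝟙 (a == z) +_) (count-remove′ d r q3 z)) (+-leftComm (𝟙 (a == z)) (𝟙 (d == z)) (count z r2))))))

OccursM-extract : ∀ ts x us c d c2 → OccursM x ts us c → remove d c ≡ just c2 →
  Σ Term λ t' → Σ (List Term) λ r → Σ (List Term) λ Qd → Σ (List Term) λ Qr →
    (ts ↭ t' ∷ r) × Occurs x t' Qd d × OccursM x r Qr c2 × (us ≃ (Qd ++ Qr))
OccursM-extract [] x us c d c2 h q with OccursM-[] x us c h
... | _ , refl with q
...   | ()
OccursM-extract (t1 ∷ ts1) x us c d c2 h q with OccursM-cons⁻ x t1 ts1 us c h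
... | q0 , q1 , a , r , mq , dt , qa , db with d == a in da
...   | true = t1 , ts1 , q0 , q1 , ↭r , subst (0 <_) (count-== a d (∂t x t1 q0) (trans (==-sym a d) da)) dt ,
         subst (λ z → OccursM x ts1 q1 z) (just-injective (trans (sym qa) (trans (remove-== a d c (trans (==-sym a d) da)) q))) db ,
         All.lookup (splits-sound us) mq
...   | false with remove′-both d a c (remove→remove′ d c q) (remove→remove′ a c qa) da
...     | r2 , q3 , e3 with OccursM-extract ts1 x q1 r d r2 db (remove′→remove d r q3)
...       | t' , r' , Qd , Qr' , p , dtd , dbr , eq =
  t' , t1 ∷ r' , Qd , q0 ++ Qr' , ↭t (↭p t1 p) (↭s t1 t' ↭r) , dtd ,
  subst (0 <_) (countM-≃ (≃-sym e3) (∂m x (t1 ∷ r') (q0 ++ Qr'))) (OccursM-cons x t1 r' q0 Qr' a r2 dt dbr) ,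
  mk≃ (λ z → trans (ap≃ (All.lookup (splits-sound us) mq) z) (trans (count-++ z q0 q1) (trans (cong (count z q0 +_) (trans (ap≃ eq z) (count-++ z Qd Qr')))
     (trans (+-leftComm (count z q0) (count z Qd) (count z Qr')) (trans (cong (count z Qd +_) (sym (count-++ z q0 Qr'))) (sym (count-++ z Qd (q0 ++ Qr'))))))))

Coherent : List Term → Set
Coherent L = ∀ {a b} → a ∈ L → b ∈ L → a ≍ b

Coherent-⊆ : ∀ {L L'} → Coherent L → (∀ {a} → a ∈ L' → a ∈ L) → Coherent L'
Coherent-⊆ c f ma mb = c (f ma) (f mb)

≍ᵇ→Coherent : ∀ {ts us} → ts ≍ᵇ us → Coherent (ts ++ us)
≍ᵇ→Coherent (bag≍ h) ma mb = All.lookup (All.lookup h ma) mb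

Coherent-tail : ∀ {t ts} → Coherent (t ∷ ts) → Coherent ts
Coherent-tail c = Coherent-⊆ c there

Coherent-double : ∀ {ts} → Coherent ts → Coherent (ts ++ ts)
Coherent-double {ts} c = Coherent-⊆ c either-copy
  where
  either-copy : ∀ {a} → a ∈ ts ++ ts → a ∈ ts
  either-copy a∈ with ∈-++⁻ ts a∈
  ... | inj₁ a∈ts = a∈ts
  ... | inj₂ a∈ts = a∈ts

Coherent-half : ∀ {ts} → Coherent (ts ++ ts) → Coherent ts
Coherent-half c = Coherent-⊆ c ∈-++⁺ˡ

occurs-∂app⁻ : ∀ x s ts us z → 0 < count z (∂t x (app s ts) us) → Σ Term (λ a → Σ Monomial (λ b → z ≡ app a b))
occurs-∂app⁻ x s ts us z h with Head.head-view app-head z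
... | inj₁ ((a , b) , refl) = a , b , refl
... | inj₂ other = ⊥-elim (<-irrefl (sym (count-∂app-nonapp x s ts us z (λ a b → proj₁ (other (a , b))))) h)

mutual
  rigidity : ∀ s s' → s ≍ s' → ∀ x us us' a → Occurs x s us a → Occurs x s' us' a → ((s == s') ≡ true) × (us ≃ us')
  rigidity (var i) (var i) var≍ x (_ ∷ _ ∷ _) us' a () d'
  rigidity (var i) (var i) var≍ x [] (_ ∷ _ ∷ _) a d ()
  rigidity (var i) (var i) var≍ x (_ ∷ []) (_ ∷ _ ∷ _) a d ()
  rigidity (var i) (var i) var≍ x [] [] a d d' = ≡ᵇ-refl i , ≃-refl
  rigidity (var i) (var i) var≍ x [] (_ ∷ []) a d d' with i ≡ᵇ x
  ... | true = ⊥-elim (<-irrefl refl d)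
  ... | false = ⊥-elim (<-irrefl refl d')
  rigidity (var i) (var i) var≍ x (_ ∷ []) [] a d d' with i ≡ᵇ x
  ... | true = ⊥-elim (<-irrefl refl d')
  ... | false = ⊥-elim (<-irrefl refl d)
  rigidity (var i) (var i) var≍ x (u ∷ []) (u' ∷ []) a d d' with i ≡ᵇ x
  ... | false = ⊥-elim (<-irrefl refl d)
  ... | true = ≡ᵇ-refl i , ∷-== [] (==-trans {u} {a} {u'} (𝟙+0-pos _ d) (trans (==-sym a u') (𝟙+0-pos _ d')))
  rigidity (lam s) (lam s') (lam≍ h) x us us' a d d' with count-map-head⁻ lam-head a (∂t (suc x) s (shiftL 0 us)) d
  ... | a0 , refl with rigidity s s' h (suc x) (shiftL 0 us) (shiftL 0 us') a0
                         (subst (0 <_) (count-map-head lam-head a0 (∂t (suc x) s (shiftL 0 us))) d)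
                         (subst (0 <_) (count-map-head lam-head a0 (∂t (suc x) s' (shiftL 0 us'))) d')
  ...   | s==s' , us≃us' = s==s' , ≃-unshift us us' us≃us'
  rigidity (inl s) (inl s') (inl≍ h) x us us' a d d' with count-map-head⁻ inl-head a (∂t x s us) d
  ... | a0 , refl = rigidity s s' h x us us' a0 (subst (0 <_) (count-map-head inl-head a0 (∂t x s us)) d) (subst (0 <_) (count-map-head inl-head a0 (∂t x s' us')) d')
  rigidity (inr s) (inr s') (inr≍ h) x us us' a d d' with count-map-head⁻ inr-head a (∂t x s us) d
  ... | a0 , refl = rigidity s s' h x us us' a0 (subst (0 <_) (count-map-head inr-head a0 (∂t x s us)) d) (subst (0 <_) (count-map-head inr-head a0 (∂t x s' us')) d')
  rigidity (inl s) (inr s') inlr≍ x us us' a d d' with count-map-head⁻ inl-head a (∂t x s us) d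
  ... | a0 , refl with count-map-head⁻ inr-head (inl a0) (∂t x s' us') d'
  ...   | _ , ()
  rigidity (inr s) (inl s') inrl≍ x us us' a d d' with count-map-head⁻ inr-head a (∂t x s us) d
  ... | a0 , refl with count-map-head⁻ inl-head (inr a0) (∂t x s' us') d'
  ...   | _ , ()
  rigidity (app s ts) (app s' ts') (app≍ h1 h2) x us us' z d d' with occurs-∂app⁻ x s ts us z d
  ... | a , b , refl with ∑-pos _ (splits us) (subst (0 <_) (count-∂app-app x s ts us a b) d) | ∑-pos _ (splits us') (subst (0 <_) (count-∂app-app x s' ts' us' a b) d')
  ...   | (p0 ∷ p1 ∷ []) , mp , pp | (p0' ∷ p1' ∷ []) , mp' , pp'
    with *-pos⁻ _ _ pp | *-pos⁻ _ _ pp'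
  ...     | da , db | da' , db' with rigidity s s' h1 x p0 p0' a da da' | rigidityM ts ts' (≍ᵇ→Coherent h2) x p1 p1' b db db'
  ...       | e1 , e2 | f1 , f2 rewrite e1 | f1 =
    refl , ≃-trans (All.lookup (splits-sound us) mp) (≃-trans (++-≃ e2 f2) (≃-sym (All.lookup (splits-sound us') mp')))

  rigidityM : ∀ ts ts' → Coherent (ts ++ ts') → ∀ x us us' b → OccursM x ts us b → OccursM x ts' us' b → (bagEq ts ts' ≡ true) × (us ≃ us')
  rigidityM [] ts' coh x us us' b d d' with OccursM-[] x us b d
  ... | refl , refl with OccursM-[]-target x ts' us' d'
  ...   | refl with OccursM-[] x us' [] d'
  ...     | refl , _ = refl , ≃-refl
  rigidityM (t ∷ ts1) ts' coh x us us' b d d' with OccursM-cons⁻ x t ts1 us b d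
  ... | q0 , q1 , a , r , mq , dt , qa , db with OccursM-extract ts' x us' b a r d' qa
  ...   | t' , r' , Qd , Qr , p , dtd , dbr , eq
    with rigidity t t' (coh (here refl) (∈-++⁺ʳ (t ∷ ts1) (∈-resp-↭ (↭-sym p) (here refl)))) x q0 Qd a dt dtd
       | rigidityM ts1 r' (Coherent-⊆ coh sub) x q1 Qr r db dbr
    where
    sub : ∀ {z} → z ∈ ts1 ++ r' → z ∈ (t ∷ ts1) ++ ts'
    sub z∈ with ∈-++⁻ ts1 z∈
    ... | inj₁ z∈ts1 = there (∈-++⁺ˡ z∈ts1)
    ... | inj₂ z∈r' = ∈-++⁺ʳ (t ∷ ts1) (∈-resp-↭ (↭-sym p) (there z∈r'))
  ...     | e1 , e2 | f1 , f2 =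
    ≃→bag (t ∷ ts1) ts' (≃-trans (≃-trans (∷-≃ t (bag→≃ ts1 r' f1)) (∷-== r' e1)) (≃-sym (↭→≃ p))) ,
    ≃-trans (All.lookup (splits-sound us) mq) (≃-trans (++-≃ e2 f2) (≃-sym eq))

-- By induction
-- on ū: the first element u goes either to ū₁ (and is removed from A) or to
-- ū₂ (and is removed from B); the two contributions add up to
-- m(u)·(1 + #u in ū)·m(ū) since #u in A + #u in B = 1 + #u in ū.

splitWeight : List Term → List Term → Vec (List Term) 2 → ℕ
splitWeight A B = onPair (λ p0 p1 → 𝟙 (bagEq p0 A) * 𝟙 (bagEq p1 B) * (mProd p0 * mProd p1))

afterRemoving : Term → List Term → (List Term → ℕ) → ℕ
afterRemoving u A k = maybe (λ A' → m u * suc (count u A') * k A') 0 (remove u A)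

bagEq-∷ : ∀ u us X Y → Y ≃ (u ∷ X) → bagEq (u ∷ us) Y ≡ bagEq us X
bagEq-∷ u us X Y e = trans (bagEq-cong (≃-refl {u ∷ us}) e) drop-u
  where
  drop-u : bagEq (u ∷ us) (u ∷ X) ≡ bagEq us X
  drop-u rewrite ==-refl u = refl

SplitIdentity : List Term → Set
SplitIdentity us = ∀ A B → ∑ (splitWeight A B) (splits us) ≡ 𝟙 (bagEq us (A ++ B)) * mProd us

u-first : ∀ u us A B → SplitIdentity us →
  ∑ (onPair (λ p0 p1 → splitWeight A B ((u ∷ p0) ∷ p1 ∷ []))) (splits us) ≡ afterRemoving u A (λ A' → 𝟙 (bagEq us (A' ++ B)) * mProd us)
u-first u us A B ih = by-removal (remove u A) refl
  where
  first : Vec (List Term) 2 → ℕ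
  first = onPair (λ p0 p1 → splitWeight A B ((u ∷ p0) ∷ p1 ∷ []))
  by-removal : ∀ r → remove u A ≡ r → ∑ first (splits us) ≡ maybe (λ A' → m u * suc (count u A') * (𝟙 (bagEq us (A' ++ B)) * mProd us)) 0 r
  by-removal nothing q = ∑-zero _ vanish (splits us)
    where
    vanish : ∀ p → first p ≡ 0
    vanish (p0 ∷ p1 ∷ []) rewrite q = refl
  by-removal (just A') q = trans (∑-cong factor-u (splits us)) (trans (∑-*ˡ (m u * suc (count u A')) (splitWeight A' B) (splits us)) (cong (m u * suc (count u A') *_) (ih A' B)))
    where
    factor-u : ∀ p → first p ≡ m u * suc (count u A') * splitWeight A' B p
    factor-u (p0 ∷ p1 ∷ []) rewrite q with bagEq p0 A' in e
    ... | false = sym (*-zeroʳ (m u * suc (count u A')))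
    ... | true rewrite ap≃ (bag→≃ p0 A' e) u = rearrange (𝟙 (bagEq p1 B)) (mProd p0) (mProd p1) (m u) (count u A')
      where
      rearrange : ∀ b f0 f1 mu c → 1 * b * ((mu * suc c * f0) * f1) ≡ mu * suc c * (1 * b * (f0 * f1))
      rearrange = solve-∀

u-second : ∀ u us A B → SplitIdentity us →
  ∑ (onPair (λ p0 p1 → splitWeight A B (p0 ∷ (u ∷ p1) ∷ []))) (splits us) ≡ afterRemoving u B (λ B' → 𝟙 (bagEq us (A ++ B')) * mProd us)
u-second u us A B ih = by-removal (remove u B) refl
  where
  second : Vec (List Term) 2 → ℕ
  second = onPair (λ p0 p1 → splitWeight A B (p0 ∷ (u ∷ p1) ∷ []))
  by-removal : ∀ r → remove u B ≡ r → ∑ second (splits us) ≡ maybe (λ B' → m u * suc (count u B') * (𝟙 (bagEq us (A ++ B')) * mProd us)) 0 r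
  by-removal nothing q = ∑-zero _ vanish (splits us)
    where
    vanish : ∀ p → second p ≡ 0
    vanish (p0 ∷ p1 ∷ []) rewrite q | *-zeroʳ (𝟙 (bagEq p0 A)) = refl
  by-removal (just B') q = trans (∑-cong factor-u (splits us)) (trans (∑-*ˡ (m u * suc (count u B')) (splitWeight A B') (splits us)) (cong (m u * suc (count u B') *_) (ih A B')))
    where
    factor-u : ∀ p → second p ≡ m u * suc (count u B') * splitWeight A B' p
    factor-u (p0 ∷ p1 ∷ []) rewrite q with bagEq p1 B' in e
    ... | false rewrite *-zeroʳ (𝟙 (bagEq p0 A)) = sym (*-zeroʳ (m u * suc (count u B')))
    ... | true rewrite ap≃ (bag→≃ p1 B' e) u = rearrange (𝟙 (bagEq p0 A)) (mProd p0) (mProd p1) (m u) (count u B')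
      where
      rearrange : ∀ a f0 f1 mu c → a * 1 * (f0 * (mu * suc c * f1)) ≡ mu * suc c * (a * 1 * (f0 * f1))
      rearrange = solve-∀

u-both : ∀ u us A B →
  afterRemoving u A (λ A' → 𝟙 (bagEq us (A' ++ B)) * mProd us) + afterRemoving u B (λ B' → 𝟙 (bagEq us (A ++ B')) * mProd us)
  ≡ 𝟙 (bagEq (u ∷ us) (A ++ B)) * mProd (u ∷ us)
u-both u us A B = combine (remove u A) (remove u B) refl refl
  where
  E = bagEq (u ∷ us) (A ++ B)
  count-u : E ≡ true → suc (count u us) ≡ count u A + count u B
  count-u e = trans (sym (count-self u us)) (trans (ap≃ (bag→≃ (u ∷ us) (A ++ B) e) u) (count-++ u A B))
  from-A : ∀ {A'} → remove u A ≡ just A' → bagEq us (A' ++ B) ≡ E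
  from-A {A'} q = sym (bagEq-∷ u us (A' ++ B) (A ++ B) (++-≃ (remove-≃ u A q) (≃-refl {B})))
  from-B : ∀ {B'} → remove u B ≡ just B' → bagEq us (A ++ B') ≡ E
  from-B {B'} q = sym (bagEq-∷ u us (A ++ B') (A ++ B) (mk≃ λ z → trans (count-++ z A B) (trans (cong (count z A +_) (ap≃ (remove-≃ u B q) z))
         (trans (+-leftComm (count z A) (𝟙 (u == z)) (count z B')) (cong (𝟙 (u == z) +_) (sym (count-++ z A B')))))))
  both : ∀ mu a b f → mu * suc a * (1 * f) + mu * suc b * (1 * f) ≡ 1 * (mu * suc (a + suc b) * f)
  both = solve-∀
  only-A : ∀ mu a f → mu * suc a * (1 * f) + 0 ≡ 1 * (mu * suc (a + 0) * f)
  only-A = solve-∀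
  only-B : ∀ mu b f → 0 + mu * suc b * (1 * f) ≡ 1 * (mu * suc (0 + b) * f)
  only-B = solve-∀
  combine : ∀ ma mb → remove u A ≡ ma → remove u B ≡ mb →
    maybe (λ A' → m u * suc (count u A') * (𝟙 (bagEq us (A' ++ B)) * mProd us)) 0 ma +
    maybe (λ B' → m u * suc (count u B') * (𝟙 (bagEq us (A ++ B')) * mProd us)) 0 mb
    ≡ 𝟙 E * mProd (u ∷ us)
  combine (just A') (just B') qa qb rewrite from-A qa | from-B qb with E in e
  ... | false rewrite *-zeroʳ (m u * suc (count u A')) | *-zeroʳ (m u * suc (count u B')) = refl
  ... | true rewrite suc-injective (trans (count-u e) (cong₂ _+_ (count-remove u A qa) (count-remove u B qb))) = both (m u) (count u A') (count u B') (mProd us)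
  combine (just A') nothing qa qb rewrite from-A qa with E in e
  ... | false rewrite *-zeroʳ (m u * suc (count u A')) = refl
  ... | true rewrite suc-injective (trans (count-u e) (cong₂ _+_ (count-remove u A qa) (count-remove-nothing u B qb))) = only-A (m u) (count u A') (mProd us)
  combine nothing (just B') qa qb rewrite from-B qb with E in e
  ... | false rewrite *-zeroʳ (m u * suc (count u B')) = refl
  ... | true rewrite suc-injective (trans (count-u e) (cong₂ _+_ (count-remove-nothing u A qa) (count-remove u B qb))) = only-B (m u) (count u B') (mProd us)
  combine nothing nothing qa qb with E in e
  ... | false = refl
  ... | true with trans (count-u e) (cong₂ _+_ (count-remove-nothing u A qa) (count-remove-nothing u B qb))
  ...   | ()

splits-mProd : ∀ us → SplitIdentity us
splits-mProd [] [] [] = refl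
splits-mProd [] [] (_ ∷ _) = refl
splits-mProd [] (_ ∷ _) B = refl
splits-mProd (u ∷ us) A B = begin
  ∑ (splitWeight A B) (splits (u ∷ us))
    ≡⟨ assignments-cons 2 u us (splitWeight A B) ⟩
  ∑ (λ p → ∑Fin 2 (λ i → splitWeight A B (updateAt p i (u ∷_)))) (splits us)
    ≡⟨ ∑-cong (λ { (p0 ∷ p1 ∷ []) → cong (first (p0 ∷ p1 ∷ []) +_) (+-identityʳ _) }) (splits us) ⟩
  ∑ (λ p → first p + second p) (splits us)
    ≡⟨ ∑-+ first second (splits us) ⟩
  ∑ first (splits us) + ∑ second (splits us)
    ≡⟨ cong₂ _+_ (u-first u us A B (splits-mProd us)) (u-second u us A B (splits-mProd us)) ⟩
  afterRemoving u A (λ A' → 𝟙 (bagEq us (A' ++ B)) * mProd us) + afterRemoving u B (λ B' → 𝟙 (bagEq us (A ++ B')) * mProd us)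
    ≡⟨ u-both u us A B ⟩
  𝟙 (bagEq (u ∷ us) (A ++ B)) * mProd (u ∷ us) ∎
  where
  open ≡-Reasoning
  first second : Vec (List Term) 2 → ℕ
  first = onPair (λ p0 p1 → splitWeight A B ((u ∷ p0) ∷ p1 ∷ []))
  second = onPair (λ p0 p1 → splitWeight A B (p0 ∷ (u ∷ p1) ∷ []))

mBag-≃ : ∀ xs ys → xs ≃ ys → mBag xs ≡ mBag ys
mBag-≃ xs ys e = mBag-sameBag xs ys (m-==All xs) (≃→sameBag xs ys e)

mBag-cons : ∀ u us → mBag (u ∷ us) ≡ m u * suc (count u us) * mBag us
mBag-cons u us = trans (mBag≡mProd (u ∷ us)) (cong (m u * suc (count u us) *_) (sym (mBag≡mProd us)))

splits-mBag : ∀ us A B → ∑ (onPair (λ p0 p1 → 𝟙 (bagEq p0 A) * 𝟙 (bagEq p1 B) * (mBag p0 * mBag p1))) (splits us) ≡ 𝟙 (bagEq us (A ++ B)) * mBag us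
splits-mBag us A B = trans (∑-cong to-mProd (splits us)) (trans (splits-mProd us A B) (cong (𝟙 (bagEq us (A ++ B)) *_) (sym (mBag≡mProd us))))
  where
  to-mProd : ∀ p → onPair (λ p0 p1 → 𝟙 (bagEq p0 A) * 𝟙 (bagEq p1 B) * (mBag p0 * mBag p1)) p ≡ splitWeight A B p
  to-mProd (p0 ∷ p1 ∷ []) = cong (𝟙 (bagEq p0 A) * 𝟙 (bagEq p1 B) *_) (cong₂ _*_ (mBag≡mProd p0) (mBag≡mProd p1))

-- By rigidity, among the splittings (p₀, p₁) of ū only the one equal to
-- (A, B) can produce a given pair a ∈ ∂ₓs·A, b ∈ ∂ₓt̄·B.
sign-occurs : ∀ s ts → s ≍ s → Coherent (ts ++ ts) → ∀ x a b A B → 0 < count a (∂t x s A) → 0 < countM b (∂m x ts B) →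
  ∀ p0 p1 → sign (count a (∂t x s p0)) * sign (countM b (∂m x ts p1)) ≡ 𝟙 (bagEq p0 A) * 𝟙 (bagEq p1 B)
sign-occurs s ts h coh x a b A B pA pB p0 p1 with count a (∂t x s p0) in e1 | countM b (∂m x ts p1) in e2
... | suc _ | suc _ rewrite ≃→bag p0 A (proj₂ (rigidity s s h x p0 A a (subst (0 <_) (sym e1) (s≤s z≤n)) pA))
                          | ≃→bag p1 B (proj₂ (rigidityM ts ts coh x p1 B b (subst (0 <_) (sym e2) (s≤s z≤n)) pB)) = refl
... | zero | _ rewrite ¬-not {bagEq p0 A} {true} (λ q → <-irrefl (trans (sym e1) (∂t-≃ s x p0 A (bag→≃ p0 A q) a)) pA) = refl
... | suc _ | zero rewrite ¬-not {bagEq p1 B} {true} (λ q → <-irrefl (trans (sym e2) (∂m-≃ ts x p1 B (bag→≃ p1 B q) b)) pB)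
                        | *-zeroʳ (𝟙 (bagEq p0 A)) = refl

CoeffLawT : Term → Set
CoeffLawT s = ∀ x us a → count a (∂t x s us) * m a ≡ sign (count a (∂t x s us)) * (m s * mBag us)

CoeffLawM : List Term → Set
CoeffLawM ts = ∀ x us b → countM b (∂m x ts us) * mBag b ≡ sign (countM b (∂m x ts us)) * (mBag ts * mBag us)

-- Application case: each splitting contributes sign·sign·m(s)m(t̄)m(ū₁)m(ū₂)
-- by induction, and the splitting identity sums this to m(s)m(t̄)m(ū).
coeff-app : ∀ s ts → s ≍ s → Coherent (ts ++ ts) → CoeffLawT s → CoeffLawM ts → ∀ x us a b → 0 < count (app a b) (∂t x (app s ts) us) →
  count (app a b) (∂t x (app s ts) us) * (m a * mBag b) ≡ (m s * mBag ts) * mBag us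
coeff-app s ts h coh ihs ihts x us a b pos with ∑-pos _ (splits us) (subst (0 <_) (count-∂app-app x s ts us a b) pos)
... | (A ∷ B ∷ []) , mq , pq with *-pos⁻ _ _ pq
...   | pA , pB = begin
  count (app a b) (∂t x (app s ts) us) * (m a * mBag b)
    ≡⟨ cong (_* (m a * mBag b)) (count-∂app-app x s ts us a b) ⟩
  ∑ P (splits us) * (m a * mBag b)
    ≡⟨ sym (∑-*ʳ (m a * mBag b) P (splits us)) ⟩
  ∑ (λ p → P p * (m a * mBag b)) (splits us)
    ≡⟨ ∑-cong per-split (splits us) ⟩
  ∑ (λ p → m s * mBag ts * Q p) (splits us)
    ≡⟨ ∑-*ˡ (m s * mBag ts) Q (splits us) ⟩
  m s * mBag ts * ∑ Q (splits us)
    ≡⟨ cong (m s * mBag ts *_) (splits-mBag us A B) ⟩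
  m s * mBag ts * (𝟙 (bagEq us (A ++ B)) * mBag us)
    ≡⟨ cong (λ z → m s * mBag ts * (𝟙 z * mBag us)) (≃→bag us (A ++ B) (All.lookup (splits-sound us) mq)) ⟩
  m s * mBag ts * (1 * mBag us)
    ≡⟨ cong (m s * mBag ts *_) (*-identityˡ (mBag us)) ⟩
  m s * mBag ts * mBag us ∎
  where
  open ≡-Reasoning
  P Q : Vec (List Term) 2 → ℕ
  P = onPair (λ p0 p1 → count a (∂t x s p0) * countM b (∂m x ts p1))
  Q = onPair (λ p0 p1 → 𝟙 (bagEq p0 A) * 𝟙 (bagEq p1 B) * (mBag p0 * mBag p1))
  regroup : ∀ c1 c2 ma mb i1 i2 ms mts m0 m1 → c1 * ma ≡ i1 * (ms * m0) → c2 * mb ≡ i2 * (mts * m1) →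
    c1 * c2 * (ma * mb) ≡ ms * mts * (i1 * i2 * (m0 * m1))
  regroup c1 c2 ma mb i1 i2 ms mts m0 m1 e1 e2 = trans (pair-up c1 c2 ma mb) (trans (cong₂ _*_ e1 e2) (collect i1 i2 ms mts m0 m1))
    where
    pair-up : ∀ c1 c2 ma mb → c1 * c2 * (ma * mb) ≡ (c1 * ma) * (c2 * mb)
    pair-up = solve-∀
    collect : ∀ i1 i2 ms mts m0 m1 → (i1 * (ms * m0)) * (i2 * (mts * m1)) ≡ ms * mts * (i1 * i2 * (m0 * m1))
    collect = solve-∀
  per-split : ∀ p → P p * (m a * mBag b) ≡ m s * mBag ts * Q p
  per-split (p0 ∷ p1 ∷ []) =
    trans (regroup (count a (∂t x s p0)) (countM b (∂m x ts p1)) (m a) (mBag b) (sign (count a (∂t x s p0))) (sign (countM b (∂m x ts p1)))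
                   (m s) (mBag ts) (mBag p0) (mBag p1) (ihs x p0 a) (ihts x p1 b))
          (cong (λ z → m s * mBag ts * (z * (mBag p0 * mBag p1))) (sign-occurs s ts h coh x a b A B pA pB p0 p1))

∑-count-swap : ∀ (b : Monomial) (φ : Term → ℕ) → Respects== φ → ∀ L → ∑ (λ a → φ a * count a b) L ≡ ∑ (λ d → count d L * φ d) b
∑-count-swap b φ rφ L =
  trans (∑-cong (λ a → sym (∑-*ˡ (φ a) (λ d → 𝟙 (d == a)) b)) L)
  (trans (∑-swap (λ a d → φ a * 𝟙 (d == a)) L b)
  (∑-cong (λ d → trans (∑-cong (flip-indicator d) L) (∑-*ʳ (φ d) (λ a → 𝟙 (a == d)) L)) b))
  where
  flip-indicator : ∀ d a → φ a * 𝟙 (d == a) ≡ 𝟙 (a == d) * φ d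
  flip-indicator d a with d == a in e
  ... | true rewrite ==-sym a d | e = trans (*-identityʳ (φ a)) (trans (rφ a d (trans (==-sym a d) e)) (sym (+-identityʳ (φ d))))
  ... | false rewrite ==-sym a d | e = *-zeroʳ (φ a)

∑-over-occurrences : ∀ t ts0 x us0 c → OccursM x ts0 us0 c → (P : Term → ℕ) → Respects== P →
  (∀ t' Q d → t' ∈ ts0 → 0 < count d c → Occurs x t' Q d → P d ≡ 𝟙 (t' == t)) → ∑ P c ≡ count t ts0
∑-over-occurrences t [] x us0 c h P rP source with OccursM-[] x us0 c h
... | _ , refl = refl
∑-over-occurrences t (t1 ∷ ts1) x us0 c h P rP source with OccursM-cons⁻ x t1 ts1 us0 c h
... | q0 , q1 , a , r , mq , dt , qa , db =
  trans (∑-≃ P rP c (a ∷ r) (remove-≃ a c qa))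
  (cong₂ _+_ (source t1 q0 a (here refl) (subst (0 <_) (sym (ap≃ (remove-≃ a c qa) a)) (subst (0 <_) (sym (count-self a r)) (s≤s z≤n))) dt)
             (∑-over-occurrences t ts1 x q1 r db P rP (λ t' Q d t'∈ d∈r dq → source t' Q d (there t'∈) (in-c d d∈r) dq)))
  where
  in-c : ∀ d → 0 < count d r → 0 < count d c
  in-c d d∈r = ≤-trans d∈r (≤-trans (m≤n+m (count d r) (𝟙 (a == d))) (≤-reflexive (sym (ap≃ (remove-≃ a c qa) d))))

-- By the induction hypotheses,
-- coeff·m(b) = m(t)m(t̄) · ∑_{d ∈ b} sign(#splittings producing d from t and
-- b - d from t̄) · m(ū), and by rigidity exactly 1 + #t in t̄ elements d of b
-- can be produced from t.
module ConsCase (t : Term) (ts : List Term) (coh : Coherent (t ∷ ts)) (ihT : CoeffLawT t) (ihB : CoeffLawM ts)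
                (x : ℕ) (us : List Term) (b : Monomial) where

  headSum : List Term → List Term
  headSum q0 = ∂t x t q0

  tailSum : List Term → List Monomial
  tailSum q1 = ∂m x ts q1

  tailSign : List Term → Term → ℕ
  tailSign q1 d = maybe (λ r → sign (countM r (tailSum q1))) 0 (remove d b)

  splitSign : Term → Vec (List Term) 2 → ℕ
  splitSign d = onPair (λ q0 q1 → sign (count d (headSum q0)) * tailSign q1 d)

  splitMult : Vec (List Term) 2 → ℕ
  splitMult = onPair (λ q0 q1 → mBag q0 * mBag q1)

  producible : Term → ℕ
  producible d = ∑ (splitSign d) (splits us)

  t≍t : t ≍ t
  t≍t = coh (here refl) (here refl)

  ts-coherent : Coherent (ts ++ ts)
  ts-coherent = Coherent-double (Coherent-tail coh)

  tailSign-== : ∀ q1 → Respects== (tailSign q1)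
  tailSign-== q1 d d' e rewrite remove-== d d' b e = refl

  tailSign-just : ∀ q1 d r → remove d b ≡ just r → tailSign q1 d ≡ sign (countM r (tailSum q1))
  tailSign-just q1 d r q rewrite q = refl

  tailSign-pos : ∀ q1 d → 0 < tailSign q1 d → Σ Monomial λ r → (remove d b ≡ just r) × (0 < countM r (tailSum q1))
  tailSign-pos q1 d h with remove d b in q
  ... | just r = r , refl , sign-pos⁻ _ h

  tail-law : ∀ q1 a → countAfter a b (tailSum q1) * mBag b ≡ (mBag ts * mBag q1) * (m a * tailSign q1 a * count a b)
  tail-law q1 a with remove a b in q
  ... | nothing rewrite *-zeroʳ (m a) | *-zeroʳ (mBag ts * mBag q1) = refl
  ... | just r = trans (cong (countM r (tailSum q1) *_) (trans (mBag-≃ b (a ∷ r) (remove-≃ a b q)) (mBag-cons a r)))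
      (trans (rearrange (countM r (tailSum q1)) (m a) (count a r) (mBag r) (sign (countM r (tailSum q1))) (mBag ts * mBag q1) (ihB x q1 r))
       (cong (λ z → mBag ts * mBag q1 * (m a * sign (countM r (tailSum q1)) * z)) (sym (count-remove a b q))))
    where
    rearrange : ∀ c ma k mr i K → c * mr ≡ i * K → c * (ma * suc k * mr) ≡ K * (ma * i * suc k)
    rearrange c ma k mr i K e = trans (pull c ma k mr) (trans (cong (ma * suc k *_) e) (push ma k i K))
      where
      pull : ∀ c ma k mr → c * (ma * suc k * mr) ≡ ma * suc k * (c * mr)
      pull = solve-∀
      push : ∀ ma k i K → ma * suc k * (i * K) ≡ K * (ma * i * suc k)
      push = solve-∀

  head-law : ∀ q0 q1 → ∑ (λ a → countAfter a b (tailSum q1) * mBag b) (headSum q0) ≡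
                       ∑ (λ d → (m t * mBag ts) * (splitSign d (q0 ∷ q1 ∷ []) * splitMult (q0 ∷ q1 ∷ []))) b
  head-law q0 q1 =
    trans (∑-cong (tail-law q1) (headSum q0))
    (trans (∑-*ˡ (mBag ts * mBag q1) (λ a → m a * tailSign q1 a * count a b) (headSum q0))
    (trans (cong (mBag ts * mBag q1 *_) (∑-count-swap b (λ a → m a * tailSign q1 a) (λ a a' e → cong₂ _*_ (m-== a a' e) (tailSign-== q1 a a' e)) (headSum q0)))
    (trans (sym (∑-*ˡ (mBag ts * mBag q1) (λ d → count d (headSum q0) * (m d * tailSign q1 d)) b))
    (∑-cong (λ d → rearrange (count d (headSum q0)) (m d) (tailSign q1 d) (sign (count d (headSum q0))) (m t) (mBag q0) (mBag ts) (mBag q1) (ihT x q0 d)) b))))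
    where
    rearrange : ∀ c md ρ i mt m0 mts m1 → c * md ≡ i * (mt * m0) → (mts * m1) * (c * (md * ρ)) ≡ mt * mts * (i * ρ * (m0 * m1))
    rearrange c md ρ i mt m0 mts m1 e = trans (pull c md ρ mts m1) (trans (cong (λ z → mts * m1 * (z * ρ)) e) (push i mt m0 ρ mts m1))
      where
      pull : ∀ c md ρ mts m1 → (mts * m1) * (c * (md * ρ)) ≡ mts * m1 * ((c * md) * ρ)
      pull = solve-∀
      push : ∀ i mt m0 ρ mts m1 → mts * m1 * (i * (mt * m0) * ρ) ≡ mt * mts * (i * ρ * (m0 * m1))
      push = solve-∀

  -- For fixed d, the splitting identity collapses the sum over splittings.
  collapse : ∀ d → ∑ (λ q → splitSign d q * splitMult q) (splits us) ≡ sign (producible d) * mBag us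
  collapse d with producible d in e
  ... | zero = ∑-*-zero (splitSign d) splitMult (splits us) e
  ... | suc _ with ∑-pos (splitSign d) (splits us) (subst (0 <_) (sym e) (s≤s z≤n))
  ...   | (A ∷ B ∷ []) , mq , pq with *-pos⁻ _ _ pq
  ...     | pa , pr with tailSign-pos B d pr
  ...       | r , qr , pB =
    trans (∑-cong only-A,B (splits us)) (trans (splits-mBag us A B)
      (cong (λ z → 𝟙 z * mBag us) (≃→bag us (A ++ B) (All.lookup (splits-sound us) mq))))
    where
    only-A,B : ∀ q → splitSign d q * splitMult q ≡ onPair (λ p0 p1 → 𝟙 (bagEq p0 A) * 𝟙 (bagEq p1 B) * (mBag p0 * mBag p1)) q
    only-A,B (q0 ∷ q1 ∷ []) = cong (_* (mBag q0 * mBag q1))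
      (trans (cong (sign (count d (headSum q0)) *_) (tailSign-just q1 d r qr))
             (sign-occurs t ts t≍t ts-coherent x d r A B (sign-pos⁻ _ pa) pB q0 q1))

  coefficient-by-elements : countM b (∂m x (t ∷ ts) us) * mBag b ≡ (m t * mBag ts) * ∑ (λ d → sign (producible d) * mBag us) b
  coefficient-by-elements = begin
    countM b (∂m x (t ∷ ts) us) * mBag b
      ≡⟨ cong (_* mBag b) (countM-∂m-cons x t ts us b) ⟩
    ∑ R (splits us) * mBag b
      ≡⟨ sym (∑-*ʳ (mBag b) R (splits us)) ⟩
    ∑ (λ q → R q * mBag b) (splits us)
      ≡⟨ ∑-cong per-split (splits us) ⟩
    ∑ (λ q → ∑ (λ d → k * (splitSign d q * splitMult q)) b) (splits us)
      ≡⟨ ∑-swap (λ q d → k * (splitSign d q * splitMult q)) (splits us) b ⟩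
    ∑ (λ d → ∑ (λ q → k * (splitSign d q * splitMult q)) (splits us)) b
      ≡⟨ ∑-cong (λ d → trans (∑-*ˡ k (λ q → splitSign d q * splitMult q) (splits us)) (cong (k *_) (collapse d))) b ⟩
    ∑ (λ d → k * (sign (producible d) * mBag us)) b
      ≡⟨ ∑-*ˡ k (λ d → sign (producible d) * mBag us) b ⟩
    k * ∑ (λ d → sign (producible d) * mBag us) b ∎
    where
    open ≡-Reasoning
    k : ℕ
    k = m t * mBag ts
    R : Vec (List Term) 2 → ℕ
    R = onPair (λ q0 q1 → ∑ (λ a → countAfter a b (tailSum q1)) (headSum q0))
    per-split : ∀ q → R q * mBag b ≡ ∑ (λ d → k * (splitSign d q * splitMult q)) b
    per-split (q0 ∷ q1 ∷ []) = trans (sym (∑-*ʳ (mBag b) (λ a → countAfter a b (tailSum q1)) (headSum q0))) (head-law q0 q1)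

  producible-== : Respects== (λ d → sign (producible d))
  producible-== d d' e = cong sign (∑-cong (λ { (q0 ∷ q1 ∷ []) → cong₂ _*_ (cong sign (count-== d d' (headSum q0) e)) (tailSign-== q1 d d' e) }) (splits us))

  splitSign-≃ : ∀ d → Respects≃ (splitSign d)
  splitSign-≃ d (q0 ∷ q1 ∷ []) (q0' ∷ q1' ∷ []) (e0 , e1 , _) = cong₂ _*_ (cong sign (∂t-≃ t x q0 q0' e0 d)) (same-tail (remove d b))
    where
    same-tail : ∀ mr → maybe (λ r → sign (countM r (tailSum q1))) 0 mr ≡ maybe (λ r → sign (countM r (tailSum q1'))) 0 mr
    same-tail nothing = refl
    same-tail (just r) = cong sign (∂m-≃ ts x q1 q1' e1 r)

  -- An element produced by a factor t' ≠ t cannot be produced by t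
  -- (rigidity, t ≍ t').
  not-producible : ∀ t' Q d → t' ∈ ts → Occurs x t' Q d → (t' == t) ≡ false → sign (producible d) ≡ 0
  not-producible t' Q d t'∈ts dq ne with producible d in e
  ... | zero = refl
  ... | suc _ with ∑-pos (splitSign d) (splits us) (subst (0 <_) (sym e) (s≤s z≤n))
  ...   | (q0 ∷ q1 ∷ []) , _ , pq with rigidity t t' (coh (here refl) (there t'∈ts)) x q0 Q d (sign-pos⁻ _ (proj₁ (*-pos⁻ _ _ pq))) dq
  ...     | t==t' , _ = ⊥-elim (false≢true (trans (sym ne) (trans (==-sym t' t) t==t')))

  remains-in-b : ∀ a* c* → remove a* b ≡ just c* → ∀ d → 0 < count d c* → 0 < count d b
  remains-in-b a* c* qa* d d∈c* = ≤-trans d∈c* (≤-trans (m≤n+m (count d c*) (𝟙 (a* == d))) (≤-reflexive (sym (ap≃ (remove-≃ a* b qa*) d))))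

  -- Given the decomposition b = a* ∷ c* coming from the splitting (A*, B*),
  -- an element d of c* produced by a factor equal to t can also be produced
  -- by t: exchange the roles of the head t and that factor.
  producible-from-t : ∀ A* B* a* c* → (A* ∷ B* ∷ []) ∈ splits us → Occurs x t A* a* → remove a* b ≡ just c* → OccursM x ts B* c* →
    ∀ t' Q d → 0 < count d c* → Occurs x t' Q d → (t' == t) ≡ true → 0 < producible d
  producible-from-t A* B* a* c* mq* dt* qa* db* t' Q d d∈c* dq t'==t with remove′-some d c* d∈c*
  ... | c2 , rq with OccursM-extract ts x B* c* d c2 db* (remove′→remove d c* rq)
  ...   | t'' , r' , Qd , Qr , pp , dtd , dbr , eq with remove′-some d b (remains-in-b a* c* qa* d d∈c*)
  ...     | rd , rqd =
    subst (0 <_) (sym (assignments-≃ 2 (splitSign d) (splitSign-≃ d) us (Qd ++ (A* ++ Qr)) us≃))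
      (≤-trans produced-here (∑-≥ (splitSign d) (split-∈ Qd (A* ++ Qr))))
    where
    t==t'' : (t == t'') ≡ true
    t==t'' = proj₁ (rigidity t t'' (coh (here refl) (there (∈-resp-↭ (↭-sym pp) (here refl)))) x Q Qd d
                      (subst (0 <_) (count-∂t-== t' t t'==t x Q d) dq) dtd)
    d-from-t : Occurs x t Qd d
    d-from-t = subst (0 <_) (count-∂t-== t'' t (trans (==-sym t'' t) t==t'') x Qd d) dtd
    rest-from-ts : OccursM x ts (A* ++ Qr) (a* ∷ c2)
    rest-from-ts = subst (0 <_) (countM-∂m-bagEq (t ∷ r') ts (≃→bag (t ∷ r') ts (≃-trans (∷-== r' t==t'') (≃-sym (↭→≃ pp)))) x (A* ++ Qr) (a* ∷ c2))
                     (OccursM-cons x t r' A* Qr a* c2 dt* dbr)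
    rd≃ : rd ≃ (a* ∷ c2)
    rd≃ = mk≃ λ z → +-cancelˡ-≡ (𝟙 (d == z)) _ _ (trans (sym (count-remove′ d b rqd z)) (trans (count-remove′ a* b (remove→remove′ a* b qa*) z)
             (trans (cong (𝟙 (a* == z) +_) (count-remove′ d c* rq z)) (+-leftComm (𝟙 (a* == z)) (𝟙 (d == z)) (count z c2)))))
    us≃ : us ≃ (Qd ++ (A* ++ Qr))
    us≃ = mk≃ λ z → trans (ap≃ (All.lookup (splits-sound us) mq*) z) (trans (count-++ z A* B*) (trans (cong (count z A* +_) (trans (ap≃ eq z) (count-++ z Qd Qr)))
            (trans (+-leftComm (count z A*) (count z Qd) (count z Qr)) (trans (cong (count z Qd +_) (sym (count-++ z A* Qr))) (sym (count-++ z Qd (A* ++ Qr)))))))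
    produced-here : 0 < splitSign d (Qd ∷ (A* ++ Qr) ∷ [])
    produced-here = subst (0 <_) (sym (cong₂ _*_ (sign-pos d-from-t)
                      (trans (tailSign-just (A* ++ Qr) d rd (remove′→remove d b rqd)) (sign-pos (subst (0 <_) (countM-≃ (≃-sym rd≃) (tailSum (A* ++ Qr))) rest-from-ts)))))
                      (s≤s z≤n)

  elements-from-head : 0 < countM b (∂m x (t ∷ ts) us) → ∑ (λ d → sign (producible d)) b ≡ suc (count t ts)
  elements-from-head pos with OccursM-cons⁻ x t ts us b pos
  ... | A* , B* , a* , c* , mq* , dt* , qa* , db* =
    trans (∑-≃ (λ d → sign (producible d)) producible-== b (a* ∷ c*) (remove-≃ a* b qa*))
          (cong₂ _+_ head-producible (∑-over-occurrences t ts x B* c* db* (λ d → sign (producible d)) producible-== source))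
    where
    head-producible : sign (producible a*) ≡ 1
    head-producible = sign-pos (≤-trans (subst (0 <_) (sym (cong₂ _*_ (sign-pos dt*) (trans (tailSign-just B* a* c* qa*) (sign-pos db*)))) (s≤s z≤n))
                                        (∑-≥ (splitSign a*) mq*))
    source : ∀ t' Q d → t' ∈ ts → 0 < count d c* → Occurs x t' Q d → sign (producible d) ≡ 𝟙 (t' == t)
    source t' Q d t'∈ts d∈c* dq with t' == t in e
    ... | false = not-producible t' Q d t'∈ts dq e
    ... | true = sign-pos (producible-from-t A* B* a* c* mq* dt* qa* db* t' Q d d∈c* dq e)

  result : 0 < countM b (∂m x (t ∷ ts) us) → countM b (∂m x (t ∷ ts) us) * mBag b ≡ mBag (t ∷ ts) * mBag us
  result pos = begin
    countM b (∂m x (t ∷ ts) us) * mBag b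
      ≡⟨ coefficient-by-elements ⟩
    m t * mBag ts * ∑ (λ d → sign (producible d) * mBag us) b
      ≡⟨ cong (m t * mBag ts *_) (∑-*ʳ (mBag us) (λ d → sign (producible d)) b) ⟩
    m t * mBag ts * (∑ (λ d → sign (producible d)) b * mBag us)
      ≡⟨ cong (λ n → m t * mBag ts * (n * mBag us)) (elements-from-head pos) ⟩
    m t * mBag ts * (suc (count t ts) * mBag us)
      ≡⟨ regroup (m t) (mBag ts) (count t ts) (mBag us) ⟩
    m t * suc (count t ts) * mBag ts * mBag us
      ≡⟨ cong (_* mBag us) (sym (mBag-cons t ts)) ⟩
    mBag (t ∷ ts) * mBag us ∎
    where
    open ≡-Reasoning
    regroup : ∀ a b c d → a * b * (suc c * d) ≡ a * suc c * b * d
    regroup = solve-∀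

mutual
  coeffLawT : ∀ s → s ≍ s → CoeffLawT s
  coeffLawT s h x us a = sign-form (count a (∂t x s us)) (m a) (m s * mBag us) (coeffLawT⁺ s h x us a)

  coeffLawT⁺ : ∀ s → s ≍ s → ∀ x us a → 0 < count a (∂t x s us) → count a (∂t x s us) * m a ≡ m s * mBag us
  coeffLawT⁺ (var y) var≍ x (_ ∷ _ ∷ _) a ()
  coeffLawT⁺ (var y) var≍ x [] a pos with y ≡ᵇ x
  ... | true = ⊥-elim (<-irrefl refl pos)
  ... | false = trans (cong (λ z → (𝟙 z + 0) * m a) (𝟙+0-pos _ pos)) (cong (1 *_) (sym (m-== (var y) a (𝟙+0-pos _ pos))))
  coeffLawT⁺ (var y) var≍ x (u ∷ []) a pos with y ≡ᵇ x
  ... | false = ⊥-elim (<-irrefl refl pos)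
  ... | true = trans (cong (λ z → (𝟙 z + 0) * m a) (𝟙+0-pos _ pos))
       (trans (cong (1 *_) (sym (m-== u a (𝟙+0-pos _ pos)))) (unit (m u)))
    where
    unit : ∀ a → 1 * a ≡ (a * 1 + 0) * 1 + 0
    unit = solve-∀
  coeffLawT⁺ (lam s) (lam≍ h) x us a pos with count-map-head⁻ lam-head a (∂t (suc x) s (shiftL 0 us)) pos
  ... | a0 , refl = trans (coeffLawT-head lam-head s h (suc x) (shiftL 0 us) a0 pos) (cong (m s *_) (mBag-shift 0 us))
  coeffLawT⁺ (inl s) (inl≍ h) x us a pos with count-map-head⁻ inl-head a (∂t x s us) pos
  ... | a0 , refl = coeffLawT-head inl-head s h x us a0 pos
  coeffLawT⁺ (inr s) (inr≍ h) x us a pos with count-map-head⁻ inr-head a (∂t x s us) pos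
  ... | a0 , refl = coeffLawT-head inr-head s h x us a0 pos
  coeffLawT⁺ (app s ts) (app≍ h1 h2) x us z pos with occurs-∂app⁻ x s ts us z pos
  ... | a , b , refl = coeff-app s ts h1 (≍ᵇ→Coherent h2) (coeffLawT s h1) (coeffLawM ts (Coherent-half (≍ᵇ→Coherent h2))) x us a b pos

  coeffLawT-head : ∀ {f} → Head _==_ f → ∀ s → s ≍ s → ∀ x us a0 → 0 < count (f a0) (map f (∂t x s us)) →
    count (f a0) (map f (∂t x s us)) * m a0 ≡ m s * mBag us
  coeffLawT-head {f} h s s≍s x us a0 pos = begin
    count (f a0) (map f (∂t x s us)) * m a0 ≡⟨ cong (_* m a0) (count-map-head h a0 (∂t x s us)) ⟩
    count a0 (∂t x s us) * m a0              ≡⟨ coeffLawT s s≍s x us a0 ⟩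
    sign (count a0 (∂t x s us)) * (m s * mBag us)
      ≡⟨ cong (_* (m s * mBag us)) (sign-pos (subst (0 <_) (count-map-head h a0 (∂t x s us)) pos)) ⟩
    1 * (m s * mBag us)                      ≡⟨ *-identityˡ _ ⟩
    m s * mBag us                            ∎
    where
    open ≡-Reasoning

  coeffLawM : ∀ ts → Coherent ts → CoeffLawM ts
  coeffLawM ts coh x us b = sign-form (countM b (∂m x ts us)) (mBag b) (mBag ts * mBag us) (coeffLawM⁺ ts coh x us b)

  coeffLawM⁺ : ∀ ts → Coherent ts → ∀ x us b → 0 < countM b (∂m x ts us) → countM b (∂m x ts us) * mBag b ≡ mBag ts * mBag us
  coeffLawM⁺ [] coh x us b pos with OccursM-[] x us b pos
  ... | refl , refl = refl
  coeffLawM⁺ (t ∷ ts) coh x us b pos = ConsCase.result t ts coh (coeffLawT t (coh (here refl) (here refl))) (coeffLawM ts (Coherent-tail coh)) x us b pos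

coeff-∑ : ∀ E e → coeff E e ≡ ∑ (λ d → 𝟙 (d ==ᵉ e)) E
coeff-∑ [] e = refl
coeff-∑ (d ∷ E) e with d ==ᵉ e
... | true = cong suc (coeff-∑ E e)
... | false = coeff-∑ E e

coeff-term : ∀ L a → coeff (map term L) (term a) ≡ count a L
coeff-term L a = trans (coeff-∑ (map term L) (term a)) (∑-map _ term L)

coeff-mono : ∀ L b → coeff (map mono L) (mono b) ≡ countM b L
coeff-mono L b = trans (coeff-∑ (map mono L) (mono b)) (∑-map _ mono L)

coeff-term-mono : ∀ L b → coeff (map term L) (mono b) ≡ 0
coeff-term-mono L b = trans (coeff-∑ (map term L) (mono b)) (trans (∑-map _ term L) (∑-zero _ (λ _ → refl) L))

coeff-mono-term : ∀ L a → coeff (map mono L) (term a) ≡ 0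
coeff-mono-term L a = trans (coeff-∑ (map mono L) (term a)) (trans (∑-map _ mono L) (∑-zero _ (λ _ → refl) L))

lemma5p20 : (x : ℕ) (e : Expr) (t̄ : List Term) (e' : Expr) →
    e ≍ᵉ e → 0 < coeff (∂ x e t̄) e' →
    coeff (∂ x e t̄) e' * mᵉ e' ≡ mᵉ e * mBag t̄
lemma5p20 x (term s) t̄ (term a) (term≍ s≍s) pos =
  trans (cong (_* m a) (coeff-term (∂t x s t̄) a)) (coeffLawT⁺ s s≍s x t̄ a (subst (0 <_) (coeff-term (∂t x s t̄) a) pos))
lemma5p20 x (mono ts) t̄ (mono b) (mono≍ ts≍ts) pos =
  trans (cong (_* mBag b) (coeff-mono (∂m x ts t̄) b)) (coeffLawM⁺ ts (Coherent-half (≍ᵇ→Coherent ts≍ts)) x t̄ b (subst (0 <_) (coeff-mono (∂m x ts t̄) b) pos))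
lemma5p20 x (term s) t̄ (mono b) _ pos = ⊥-elim (<-irrefl (sym (coeff-term-mono (∂t x s t̄) b)) pos)
lemma5p20 x (mono ts) t̄ (term a) _ pos = ⊥-elim (<-irrefl (sym (coeff-mono-term (∂m x ts t̄) a)) pos)
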